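{- Let $G=(A\cup P,\mathcal{E})$ be a bipartite graph with ranked edges in which $p'$ is a rank one $f$-post (with respect to $a$) in the preference list of the applicant $a$, and suppose that $a$ becomes unreachable after iteration $i$, i.e. $a\in U(G'_i)$. Let $p\in P$ with $(a,p)\notin\mathcal{E}$ and let $\hat{G}$ be obtained from $G$ by adding the edge $(a,p)$ with rank $c$. If $c>i$, then $(a,p)$ belongs to no rank-maximal matching of $\hat{G}$.
   Context: Edges $(a,p)$ carry positive integer ranks (smaller = more preferred by $a$). A matching is a set of edges no two sharing an endpoint. The signature of a matching in a graph with largest rank $r$ is $(x_1,\dots,x_r)$ with $x_i$ the number of applicants matched by rank $i$ edges; a matching is rank-maximal if its signature is lexicographically largest. $G_i$ denotes the subgraph of edges of rank at most $i$. For a bipartite graph $K$ with maximum matching $M$, a vertex is even (resp. odd) if reachable from an $M$-unmatched vertex by an $M$-alternating path of even (resp. odd) length, and unreachable otherwise; the sets $E(K),O(K),U(K)$ do not depend on $M$. Reduced graphs of $G$: $G'_1=G_1$; for $j=1,\dots,r$: compute $E(G'_j),O(G'_j),U(G'_j)$, delete all edges of rank $>j$ incident to vertices of $O(G'_j)\cup U(G'_j)$, delete from $G'_j$ all edges between $O(G'_j)$ and $O(G'_j)\cup U(G'_j)$, and let $G'_{j+1}$ be the result plus the remaining edges of rank $j+1$. A post is an $f$-post with respect to $a$ if it lies in $O(L)\cup U(L)$, where $L$ is the subgraph of rank one edges with the vertex $a$ deleted. -}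

module Defs where

open import Data.Nat using (ℕ; zero; suc; _+_; _≤_; _<_; _⊔_; _%_)
open import Data.Bool using (Bool; true; false; not; _∧_; if_then_else_)
open import Data.Fin using (Fin; _≟_)
open import Data.List using (List; []; _∷_; length; map; foldr)
open import Data.Nat.ListAction using (sum)
open import Data.List.Relation.Unary.Unique.Propositional using (Unique)
open import Data.Product using (Σ; ∃; ∃-syntax; _×_; _,_)
open import Data.Sum using (_⊎_; inj₁; inj₂)
open import Data.Unit using (⊤)
open import Data.Empty using (⊥)
open import Relation.Nullary using (¬_; does)
open import Relation.Binary.PropositionalEquality using (_≡_; _≢_)
open import Data.Fin.Base using () renaming (zero to fzero)
open import Data.List.Base using ()
import Data.List as L

-- Applicants are Fin nA, posts are Fin nP.
-- A ranked bipartite graph G is a rank function  rk : Fin nA → Fin nP → ℕ ,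
-- where  rk a p ≡ 0  means "(a,p) is not an edge", and rk a p = k ≥ 1 means
-- "(a,p) is an edge of rank k".
Ranking : ℕ → ℕ → Set
Ranking nA nP = Fin nA → Fin nP → ℕ

IsEdge : ∀ {nA nP} → Ranking nA nP → Fin nA → Fin nP → Set
IsEdge rk a p = 1 ≤ rk a p

allFin : (n : ℕ) → List (Fin n)
allFin n = L.allFin n

maxRank : ∀ {nA nP} → Ranking nA nP → ℕ
maxRank {nA} {nP} rk =
  foldr _⊔_ 0 (map (λ a → foldr _⊔_ 0 (map (λ p → rk a p) (allFin nP))) (allFin nA))

Vertex : ℕ → ℕ → Set
Vertex nA nP = Fin nA ⊎ Fin nP

-- A (sub)graph on vertex set A ∪ P is given by a vertex-membership predicate
-- V and an edge predicate K (edges join an applicant and a post).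
VSet : ℕ → ℕ → Set₁
VSet nA nP = Vertex nA nP → Set

ESet : ℕ → ℕ → Set₁
ESet nA nP = Fin nA → Fin nP → Set

EdgeSel : ℕ → ℕ → Set
EdgeSel nA nP = Fin nA → Fin nP → Bool

IsMatching : ∀ {nA nP} → VSet nA nP → ESet nA nP → EdgeSel nA nP → Set
IsMatching V K M =
  (∀ a p → M a p ≡ true → K a p × V (inj₁ a) × V (inj₂ p)) ×
  (∀ a p q → M a p ≡ true → M a q ≡ true → p ≡ q) ×
  (∀ a b p → M a p ≡ true → M b p ≡ true → a ≡ b)

size : ∀ {nA nP} → EdgeSel nA nP → ℕ
size {nA} {nP} M =
  sum (map (λ a → sum (map (λ p → if M a p then 1 else 0) (allFin nP))) (allFin nA))

IsMaxMatching : ∀ {nA nP} → VSet nA nP → ESet nA nP → EdgeSel nA nP → Set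
IsMaxMatching {nA} {nP} V K M =
  IsMatching V K M × (∀ (N : EdgeSel nA nP) → IsMatching V K N → size N ≤ size M)

KEdge : ∀ {nA nP} → ESet nA nP → Vertex nA nP → Vertex nA nP → Set
KEdge K (inj₁ a) (inj₂ p) = K a p
KEdge K (inj₂ p) (inj₁ a) = K a p
KEdge K (inj₁ _) (inj₁ _) = ⊥
KEdge K (inj₂ _) (inj₂ _) = ⊥

inM : ∀ {nA nP} → EdgeSel nA nP → Vertex nA nP → Vertex nA nP → Bool
inM M (inj₁ a) (inj₂ p) = M a p
inM M (inj₂ p) (inj₁ a) = M a p
inM M (inj₁ _) (inj₁ _) = false
inM M (inj₂ _) (inj₂ _) = false

Unmatched : ∀ {nA nP} → VSet nA nP → EdgeSel nA nP → Vertex nA nP → Set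
Unmatched {nA} {nP} V M (inj₁ a) = V (inj₁ a) × (∀ (p : Fin nP) → M a p ≡ false)
Unmatched {nA} {nP} V M (inj₂ p) = V (inj₂ p) × (∀ (a : Fin nA) → M a p ≡ false)

AltFrom : ∀ {nA nP} → ESet nA nP → EdgeSel nA nP → Bool → Vertex nA nP → List (Vertex nA nP) → Set
AltFrom K M b v [] = ⊤
AltFrom K M b v (w ∷ ws) = KEdge K v w × inM M v w ≡ b × AltFrom K M (not b) w ws

endOf : ∀ {nA nP} → Vertex nA nP → List (Vertex nA nP) → Vertex nA nP
endOf u [] = u
endOf u (w ∷ ws) = endOf w ws

AltPath : ∀ {nA nP} → ESet nA nP → EdgeSel nA nP →
          Vertex nA nP → Vertex nA nP → List (Vertex nA nP) → Set
AltPath K M u v ws = Unique (u ∷ ws) × endOf u ws ≡ v × (∃[ b ] AltFrom K M b u ws)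

EvenWrt : ∀ {nA nP} → VSet nA nP → ESet nA nP → EdgeSel nA nP → Vertex nA nP → Set
EvenWrt V K M v = ∃[ u ] ∃[ ws ] (Unmatched V M u × AltPath K M u v ws × length ws % 2 ≡ 0)

OddWrt : ∀ {nA nP} → VSet nA nP → ESet nA nP → EdgeSel nA nP → Vertex nA nP → Set
OddWrt V K M v = ∃[ u ] ∃[ ws ] (Unmatched V M u × AltPath K M u v ws × length ws % 2 ≡ 1)

-- E(K), O(K), U(K), computed w.r.t. a maximum matching M of K
-- (the sets do not depend on the choice of M).
EvenSet OddSet UnreachSet : ∀ {nA nP} → VSet nA nP → ESet nA nP → Vertex nA nP → Set
EvenSet V K v = ∃[ M ] (IsMaxMatching V K M × EvenWrt V K M v)
OddSet V K v = ∃[ M ] (IsMaxMatching V K M × OddWrt V K M v)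
UnreachSet V K v =
  V v × (∃[ M ] (IsMaxMatching V K M × ¬ EvenWrt V K M v × ¬ OddWrt V K M v))

AllV : ∀ {nA nP} → VSet nA nP
AllV _ = ⊤

restrict : ∀ {nA nP} → Ranking nA nP → ESet nA nP → ℕ → ESet nA nP
restrict rk H j a p = H a p × rk a p ≤ j

OU : ∀ {nA nP} → ESet nA nP → Vertex nA nP → Set
OU K v = OddSet AllV K v ⊎ UnreachSet AllV K v

-- One iteration j of the reduction: from the current edge set H (all ranks),
-- with G'_j = restrict H j, delete
--  * edges of rank > j incident to O(G'_j) ∪ U(G'_j),
--  * edges of G'_j between O(G'_j) and O(G'_j) ∪ U(G'_j).
prune : ∀ {nA nP} → Ranking nA nP → ℕ → ESet nA nP → ESet nA nP
prune rk j H a p =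
  H a p ×
  ¬ (j < rk a p × (OU (restrict rk H j) (inj₁ a) ⊎ OU (restrict rk H j) (inj₂ p))) ×
  ¬ (rk a p ≤ j ×
       ((OddSet AllV (restrict rk H j) (inj₁ a) × OU (restrict rk H j) (inj₂ p)) ⊎
        (OddSet AllV (restrict rk H j) (inj₂ p) × OU (restrict rk H j) (inj₁ a))))

-- current (all ranks) edge set before iteration j (j ≥ 1); current 1 = all edges of G
current : ∀ {nA nP} → Ranking nA nP → ℕ → ESet nA nP
current rk zero = IsEdge rk
current rk (suc zero) = IsEdge rk
current rk (suc (suc k)) = prune rk (suc k) (current rk (suc k))

-- reduced graph G'_j  (edges of rank ≤ j surviving the first j-1 iterations)
reduced : ∀ {nA nP} → Ranking nA nP → ℕ → ESet nA nP
reduced rk j = restrict rk (current rk j) j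

fPost : ∀ {nA nP} → Ranking nA nP → Fin nA → Fin nP → Set
fPost {nA} {nP} rk a p = OddSet VL EL (inj₂ p) ⊎ UnreachSet VL EL (inj₂ p)
  where
  VL : VSet nA nP
  VL (inj₁ b) = b ≢ a
  VL (inj₂ _) = ⊤
  EL : ESet nA nP
  EL b q = rk b q ≡ 1 × b ≢ a

sigEntry : ∀ {nA nP} → Ranking nA nP → EdgeSel nA nP → ℕ → ℕ
sigEntry {nA} {nP} rk M k =
  sum (map (λ a → sum (map (λ p → if M a p ∧ does (rk a p Data.Nat.≟ k) then 1 else 0)
                            (allFin nP))) (allFin nA))

LexLess : ℕ → (ℕ → ℕ) → (ℕ → ℕ) → Set
LexLess r x y = ∃[ j ] (1 ≤ j × j ≤ r × (∀ i → 1 ≤ i → i < j → x i ≡ y i) × x j < y j)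

MatchingOf : ∀ {nA nP} → Ranking nA nP → EdgeSel nA nP → Set
MatchingOf rk M = IsMatching AllV (IsEdge rk) M

RankMaximal : ∀ {nA nP} → Ranking nA nP → EdgeSel nA nP → Set
RankMaximal {nA} {nP} rk M =
  MatchingOf rk M ×
  (∀ (N : EdgeSel nA nP) → MatchingOf rk N →
     ¬ LexLess (maxRank rk) (sigEntry rk M) (sigEntry rk N))

addEdge : ∀ {nA nP} → Ranking nA nP → Fin nA → Fin nP → ℕ → Ranking nA nP
addEdge rk a p c b q = if does (b ≟ a) ∧ does (q ≟ p) then c else rk b q

module Submission where

-- Let M be a rank-maximal matching of Ĝ containing the new edge (a,p) of rank c > i.
-- Write N_j for the edges of M of rank ≤ j.  By induction on j = 1, …, i we show
--   (S_j)  every edge of M of rank ≤ i survives the first j - 1 pruning iterations, and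
--   (T_j)  N_j is a maximum matching of the reduced graph G'_j.
-- (S_{j+1}) follows from (T_j) because in a maximum matching every odd or unreachable
-- vertex is covered and the partner of an odd vertex is even, so no pruned edge is in M.
-- For (T_{j+1}), an augmenting path for N_{j+1} in G'_{j+1} would give a matching N' whose
-- restrictions to ranks ≤ k (k ≤ j) still have maximum size in G'_k — they cover all odd and
-- unreachable vertices and join no odd vertex to an odd or unreachable one, so they admit no
-- augmenting path — while N' has one more edge of rank ≤ j + 1: N' would beat M
-- lexicographically.  Finally a is free in the maximum matching N_i of G'_i (its M-edge has
-- rank c > i), so a is even in G'_i, contradicting a ∈ U(G'_i).

open import Defs
open import Data.Nat using (ℕ; zero; suc; _+_; _≤_; _<_; _⊔_; _%_; z≤n; s≤s; _≤ᵇ_)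
open import Data.Nat.Properties
  using (+-assoc; +-comm; +-suc; +-identityʳ; +-cancelʳ-≡; +-cancelˡ-≡; +-mono-≤; +-commutativeSemigroup;
         ≤-refl; ≤-reflexive; ≤-trans; ≤-antisym; ≤-pred; <-irrefl; <⇒≤; <⇒≱; ≮⇒≥; n≤1+n; m≤m+n; m≤n+m;
         m≤m⊔n; m≤n⊔m; m≤n⇒m<n∨m≡n; ≤ᵇ⇒≤; ≤⇒≤ᵇ)
open import Data.Nat.ListAction using (sum)
open import Data.Nat.DivMod using ([m+n]%n≡m%n)
open import Data.Bool using (Bool; true; false; not; _∧_; _xor_; if_then_else_)
open import Data.Bool.Properties using (T-≡; ⇔→≡; not-involutive; not-injective; ¬-not; not-distribˡ-xor; not-distribʳ-xor; xor-identityʳ)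
open import Data.Fin using (Fin) renaming (zero to fzero; suc to fsuc)
open import Data.Fin.Properties using (any?; ¬∀⟶∃¬) renaming (_≟_ to _≟F_; suc-injective to fsuc-injective)
open import Data.List using (List; []; _∷_; length; map; foldr; tabulate; _++_; [_])
open import Data.List.Properties using (map-tabulate; tabulate-cong; length-++-sucʳ; length-++; length-map; length-tabulate)
open import Data.List.Relation.Unary.Unique.Propositional using (Unique)
import Data.List.Relation.Unary.Unique.Propositional.Properties as Unique
open import Data.List.Relation.Unary.AllPairs using ([]; _∷_)
open import Data.List.Relation.Unary.All using (All; []; _∷_)
import Data.List.Relation.Unary.All as All
open import Data.List.Relation.Unary.Any using (here; there)
import Data.List.Relation.Unary.Any as Any
open import Data.List.Relation.Unary.All.Properties using (All¬⇒¬Any; ¬Any⇒All¬)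
open import Data.List.Membership.Propositional using (_∈_; _∉_)
open import Data.List.Membership.Propositional.Properties using (∈-map⁺; ∈-++⁺ˡ; ∈-++⁺ʳ; ∈-++⁻; ∈-∃++; ∈-allFin)
import Data.List.Membership.DecPropositional as DecMembership
open import Data.Product using (∃; _×_; _,_; proj₁; proj₂)
open import Data.Sum using (_⊎_; inj₁; inj₂)
open import Data.Sum.Properties using (≡-dec; inj₁-injective; inj₂-injective)
open import Data.Unit using (tt)
open import Data.Empty using (⊥; ⊥-elim)
open import Function.Bundles using (Equivalence; mk⇔)
open import Relation.Nullary using (¬_; Dec; yes; no; does)
open import Relation.Binary.PropositionalEquality hiding ([_])
open import Algebra.Properties.CommutativeSemigroup +-commutativeSemigroup using (interchange; xy∙z≈zy∙x; xy∙z≈xz∙y)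

bit : Bool → ℕ
bit b = if b then 1 else 0

Σᶠ : ∀ {n} → (Fin n → ℕ) → ℕ
Σᶠ h = sum (tabulate h)

Σᶠ-cong : ∀ {n} {h g : Fin n → ℕ} → (∀ i → h i ≡ g i) → Σᶠ h ≡ Σᶠ g
Σᶠ-cong h≗g = cong sum (tabulate-cong h≗g)

Σᶠ-mono : ∀ {n} {h g : Fin n → ℕ} → (∀ i → h i ≤ g i) → Σᶠ h ≤ Σᶠ g
Σᶠ-mono {zero} _ = z≤n
Σᶠ-mono {suc n} h≤g = +-mono-≤ (h≤g fzero) (Σᶠ-mono (λ i → h≤g (fsuc i)))

Σᶠ-zero : ∀ {n} {h : Fin n → ℕ} → (∀ i → h i ≡ 0) → Σᶠ h ≡ 0
Σᶠ-zero {zero} _ = refl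
Σᶠ-zero {suc n} h≗0 rewrite h≗0 fzero = Σᶠ-zero (λ i → h≗0 (fsuc i))

Σᶠ-+ : ∀ {n} (h g : Fin n → ℕ) → Σᶠ (λ i → h i + g i) ≡ Σᶠ h + Σᶠ g
Σᶠ-+ {zero} h g = refl
Σᶠ-+ {suc n} h g rewrite Σᶠ-+ (λ i → h (fsuc i)) (λ i → g (fsuc i)) =
  interchange (h fzero) (g fzero) _ _

Σᶠ-≥ : ∀ {n} (h : Fin n → ℕ) (i : Fin n) → h i ≤ Σᶠ h
Σᶠ-≥ h fzero = m≤m+n _ _
Σᶠ-≥ h (fsuc i) = ≤-trans (Σᶠ-≥ (λ j → h (fsuc j)) i) (m≤n+m _ (h fzero))

Σᶠ-point : ∀ {n} (h g : Fin n → ℕ) (i₀ : Fin n) → (∀ i → i ≢ i₀ → h i ≡ g i) →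
           Σᶠ h + g i₀ ≡ Σᶠ g + h i₀
Σᶠ-point h g fzero agree
  rewrite Σᶠ-cong {h = λ i → h (fsuc i)} {g = λ i → g (fsuc i)} (λ i → agree (fsuc i) (λ ())) =
  xy∙z≈zy∙x (h fzero) _ (g fzero)
Σᶠ-point h g (fsuc i₀) agree rewrite agree fzero (λ ()) =
  begin
    (g fzero + Σᶠ h′) + g′ i₀ ≡⟨ +-assoc (g fzero) _ _ ⟩
    g fzero + (Σᶠ h′ + g′ i₀) ≡⟨ cong (g fzero +_) (Σᶠ-point h′ g′ i₀ agree′) ⟩
    g fzero + (Σᶠ g′ + h′ i₀) ≡⟨ +-assoc (g fzero) _ _ ⟨
    (g fzero + Σᶠ g′) + h′ i₀ ∎
  where open ≡-Reasoning
        h′ g′ : _ → ℕ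
        h′ i = h (fsuc i)
        g′ i = g (fsuc i)
        agree′ : ∀ i → i ≢ i₀ → h′ i ≡ g′ i
        agree′ i i≢i₀ = agree (fsuc i) (λ eq → i≢i₀ (fsuc-injective eq))

Σᶠ-atMostOne : ∀ {n} (h : Fin n → Bool) → (∀ i j → h i ≡ true → h j ≡ true → i ≡ j) →
               Σᶠ (λ i → bit (h i)) ≤ 1
Σᶠ-atMostOne {zero} h _ = z≤n
Σᶠ-atMostOne {suc n} h once with h fzero in h₀
... | false = Σᶠ-atMostOne (λ i → h (fsuc i)) (λ i j hi hj → fsuc-injective (once _ _ hi hj))
... | true  = subst (λ s → 1 + s ≤ 1) (sym (Σᶠ-zero rest-false)) ≤-refl
  where
  rest-false : ∀ i → bit (h (fsuc i)) ≡ 0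
  rest-false i with h (fsuc i) in hᵢ
  ... | false = refl
  ... | true with () ← once fzero (fsuc i) h₀ hᵢ

-- The number of selected edges, written exactly as Defs.size, so that size M = edgeCount M
-- and sigEntry rk M k = edgeCount (M restricted to rank k) hold by definition.
edgeCount : ∀ {nA nP} → EdgeSel nA nP → ℕ
edgeCount {nA} {nP} f = sum (map (λ a → sum (map (λ p → bit (f a p)) (allFin nP))) (allFin nA))

edgeCount≡Σᶠ : ∀ {nA nP} (f : EdgeSel nA nP) → edgeCount f ≡ Σᶠ (λ a → Σᶠ (λ p → bit (f a p)))
edgeCount≡Σᶠ {nA} {nP} f =
  trans (cong sum (map-tabulate (λ (a : Fin nA) → a) _))
        (Σᶠ-cong (λ a → cong sum (map-tabulate (λ (p : Fin nP) → p) (λ p → bit (f a p)))))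

edgeCount-cong : ∀ {nA nP} {f g : EdgeSel nA nP} → (∀ a p → f a p ≡ g a p) → edgeCount f ≡ edgeCount g
edgeCount-cong {f = f} {g} f≗g =
  trans (edgeCount≡Σᶠ f)
    (trans (Σᶠ-cong (λ a → Σᶠ-cong (λ p → cong bit (f≗g a p)))) (sym (edgeCount≡Σᶠ g)))

edgeCount-zero : ∀ {nA nP} {f : EdgeSel nA nP} → (∀ a p → f a p ≡ false) → edgeCount f ≡ 0
edgeCount-zero {f = f} empty = trans (edgeCount≡Σᶠ f) (Σᶠ-zero (λ a → Σᶠ-zero (λ p → cong bit (empty a p))))

edgeCount-+ : ∀ {nA nP} (f g h : EdgeSel nA nP) → (∀ a p → bit (h a p) ≡ bit (f a p) + bit (g a p)) →
              edgeCount h ≡ edgeCount f + edgeCount g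
edgeCount-+ f g h split = begin
  edgeCount h                                                      ≡⟨ edgeCount≡Σᶠ h ⟩
  Σᶠ (λ a → Σᶠ (λ p → bit (h a p)))                                 ≡⟨ Σᶠ-cong rows ⟩
  Σᶠ (λ a → Σᶠ (λ p → bit (f a p)) + Σᶠ (λ p → bit (g a p)))       ≡⟨ Σᶠ-+ (λ a → Σᶠ (λ p → bit (f a p))) _ ⟩
  Σᶠ (λ a → Σᶠ (λ p → bit (f a p))) + Σᶠ (λ a → Σᶠ (λ p → bit (g a p)))
                                                                  ≡⟨ cong₂ _+_ (edgeCount≡Σᶠ f) (edgeCount≡Σᶠ g) ⟨
  edgeCount f + edgeCount g                                        ∎
  where
  open ≡-Reasoning
  rows : ∀ a → Σᶠ (λ p → bit (h a p)) ≡ Σᶠ (λ p → bit (f a p)) + Σᶠ (λ p → bit (g a p))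
  rows a = trans (Σᶠ-cong (split a)) (Σᶠ-+ (λ p → bit (f a p)) (λ p → bit (g a p)))

edgeCount-point : ∀ {nA nP : ℕ} (f g : EdgeSel nA nP) (a₀ : Fin nA) (p₀ : Fin nP) →
  (∀ a p → ¬ (a ≡ a₀ × p ≡ p₀) → f a p ≡ g a p) →
  edgeCount f + bit (g a₀ p₀) ≡ edgeCount g + bit (f a₀ p₀)
edgeCount-point {nA} {nP} f g a₀ p₀ agree =
  trans (cong (_+ _) (edgeCount≡Σᶠ f)) (trans in-Σᶠ (cong (_+ _) (sym (edgeCount≡Σᶠ g))))
  where
  row : EdgeSel nA nP → Fin nA → ℕ
  row k a = Σᶠ (λ p → bit (k a p))
  rows : Σᶠ (row f) + row g a₀ ≡ Σᶠ (row g) + row f a₀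
  rows = Σᶠ-point (row f) (row g) a₀
           (λ a a≢a₀ → Σᶠ-cong (λ p → cong bit (agree a p (λ (a≡a₀ , _) → a≢a₀ a≡a₀))))
  row₀ : row f a₀ + bit (g a₀ p₀) ≡ row g a₀ + bit (f a₀ p₀)
  row₀ = Σᶠ-point (λ p → bit (f a₀ p)) (λ p → bit (g a₀ p)) p₀
           (λ p p≢p₀ → cong bit (agree a₀ p (λ (_ , p≡p₀) → p≢p₀ p≡p₀)))
  in-Σᶠ : Σᶠ (row f) + bit (g a₀ p₀) ≡ Σᶠ (row g) + bit (f a₀ p₀)
  in-Σᶠ = +-cancelʳ-≡ (row f a₀) _ _ (begin
    Σᶠ (row f) + bit (g a₀ p₀) + row f a₀   ≡⟨ xy∙z≈xz∙y (Σᶠ (row f)) _ _ ⟩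
    Σᶠ (row f) + row f a₀ + bit (g a₀ p₀)   ≡⟨ +-assoc (Σᶠ (row f)) _ _ ⟩
    Σᶠ (row f) + (row f a₀ + bit (g a₀ p₀)) ≡⟨ cong (Σᶠ (row f) +_) row₀ ⟩
    Σᶠ (row f) + (row g a₀ + bit (f a₀ p₀)) ≡⟨ +-assoc (Σᶠ (row f)) _ _ ⟨
    Σᶠ (row f) + row g a₀ + bit (f a₀ p₀)   ≡⟨ cong (_+ bit (f a₀ p₀)) rows ⟩
    Σᶠ (row g) + row f a₀ + bit (f a₀ p₀)   ≡⟨ xy∙z≈xz∙y (Σᶠ (row g)) _ _ ⟩
    Σᶠ (row g) + bit (f a₀ p₀) + row f a₀   ∎)
    where open ≡-Reasoning

-- Updating one cell of a two-argument function, in the form used by Defs.addEdge.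
module _ {nA nP : ℕ} {A : Set} (f : Fin nA → Fin nP → A) (a : Fin nA) (p : Fin nP) (x : A) where
  update-hit : (if does (a ≟F a) ∧ does (p ≟F p) then x else f a p) ≡ x
  update-hit with a ≟F a | p ≟F p
  ... | yes _ | yes _   = refl
  ... | no a≢a | _      = ⊥-elim (a≢a refl)
  ... | yes _ | no p≢p  = ⊥-elim (p≢p refl)

  update-miss : ∀ b q → ¬ (b ≡ a × q ≡ p) → (if does (b ≟F a) ∧ does (q ≟F p) then x else f b q) ≡ f b q
  update-miss b q off with b ≟F a | q ≟F p
  ... | yes b≡a | yes q≡p = ⊥-elim (off (b≡a , q≡p))
  ... | yes _ | no _      = refl
  ... | no _ | _          = refl

module _ {nA nP : ℕ} where

  _≟V_ : (x y : Vertex nA nP) → Dec (x ≡ y)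
  _≟V_ = ≡-dec _≟F_ _≟F_

  inM-sym : ∀ (M : EdgeSel nA nP) x y → inM M x y ≡ inM M y x
  inM-sym M (inj₁ x) (inj₁ y) = refl
  inM-sym M (inj₁ x) (inj₂ y) = refl
  inM-sym M (inj₂ x) (inj₁ y) = refl
  inM-sym M (inj₂ x) (inj₂ y) = refl

  KEdge-sym : ∀ {K : ESet nA nP} x y → KEdge K x y → KEdge K y x
  KEdge-sym (inj₁ x) (inj₂ y) e = e
  KEdge-sym (inj₂ x) (inj₁ y) e = e

  side : Vertex nA nP → Bool
  side (inj₁ _) = true
  side (inj₂ _) = false

  KEdge-side : ∀ {K : ESet nA nP} x y → KEdge K x y → side y ≡ not (side x)
  KEdge-side (inj₁ x) (inj₂ y) e = refl
  KEdge-side (inj₂ x) (inj₁ y) e = refl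

  KEdge-≢ : ∀ {K : ESet nA nP} x y → KEdge K x y → x ≢ y
  KEdge-≢ (inj₁ x) (inj₂ y) e ()
  KEdge-≢ (inj₂ x) (inj₁ y) e ()

  IsSymMatching : ESet nA nP → EdgeSel nA nP → Set
  IsSymMatching K M = (∀ x y → inM M x y ≡ true → KEdge K x y) ×
                      (∀ x y z → inM M x y ≡ true → inM M x z ≡ true → y ≡ z)

  matched-≢ : ∀ {K M} → IsSymMatching K M → ∀ x y → inM M x y ≡ true → x ≢ y
  matched-≢ isM x y xy = KEdge-≢ x y (proj₁ isM x y xy)

  fromIsMatching : ∀ {K M} → IsMatching AllV K M → IsSymMatching K M
  fromIsMatching {K} {M} (edges , uniqA , uniqP) = inK , unique
    where
    inK : ∀ x y → inM M x y ≡ true → KEdge K x y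
    inK (inj₁ a) (inj₂ p) h = proj₁ (edges a p h)
    inK (inj₂ p) (inj₁ a) h = proj₁ (edges a p h)
    unique : ∀ x y z → inM M x y ≡ true → inM M x z ≡ true → y ≡ z
    unique (inj₁ a) (inj₂ p) (inj₂ q) h₁ h₂ = cong inj₂ (uniqA a p q h₁ h₂)
    unique (inj₂ p) (inj₁ a) (inj₁ b) h₁ h₂ = cong inj₁ (uniqP a b p h₁ h₂)
    unique (inj₁ a) (inj₂ _) (inj₁ _) _ ()
    unique (inj₂ a) (inj₁ _) (inj₂ _) _ ()

  toIsMatching : ∀ {K M} → IsSymMatching K M → IsMatching AllV K M
  toIsMatching {K} {M} (inK , unique) =
    (λ a p h → inK (inj₁ a) (inj₂ p) h , tt , tt) ,
    (λ a p q h₁ h₂ → inj₂-injective (unique (inj₁ a) (inj₂ p) (inj₂ q) h₁ h₂)) ,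
    (λ a b p h₁ h₂ → inj₁-injective (unique (inj₂ p) (inj₁ a) (inj₁ b) h₁ h₂))

  Free : EdgeSel nA nP → Vertex nA nP → Set
  Free M x = ∀ y → inM M x y ≡ false

  Covered : EdgeSel nA nP → Vertex nA nP → Set
  Covered M x = ∃ λ y → inM M x y ≡ true

  covered-free-⊥ : ∀ M x → Covered M x → Free M x → ⊥
  covered-free-⊥ M x (y , xy) free with () ← trans (sym xy) (free y)

  free⇒unmatched : ∀ {M} x → Free M x → Unmatched AllV M x
  free⇒unmatched (inj₁ a) free = tt , λ p → free (inj₂ p)
  free⇒unmatched (inj₂ p) free = tt , λ a → free (inj₁ a)

  unmatched⇒free : ∀ {M} x → Unmatched AllV M x → Free M x
  unmatched⇒free (inj₁ a) (_ , free) (inj₁ _) = refl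
  unmatched⇒free (inj₁ a) (_ , free) (inj₂ p) = free p
  unmatched⇒free (inj₂ p) (_ , free) (inj₁ a) = free a
  unmatched⇒free (inj₂ p) (_ , free) (inj₂ _) = refl

  covered? : ∀ M x → Covered M x ⊎ Free M x
  covered? M (inj₁ a) with any? (λ p → M a p Data.Bool.≟ true)
  ... | yes (p , ap) = inj₁ (inj₂ p , ap)
  ... | no none = inj₂ λ { (inj₁ _) → refl ; (inj₂ p) → ¬-not (λ ap → none (p , ap)) }
  covered? M (inj₂ p) with any? (λ a → M a p Data.Bool.≟ true)
  ... | yes (a , ap) = inj₁ (inj₁ a , ap)
  ... | no none = inj₂ λ { (inj₂ _) → refl ; (inj₁ a) → ¬-not (λ ap → none (a , ap)) }

  setCell : EdgeSel nA nP → Fin nA → Fin nP → Bool → EdgeSel nA nP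
  setCell M a p b a′ p′ = if does (a′ ≟F a) ∧ does (p′ ≟F p) then b else M a′ p′

  setEdge : EdgeSel nA nP → Vertex nA nP → Vertex nA nP → Bool → EdgeSel nA nP
  setEdge M (inj₁ a) (inj₂ p) b = setCell M a p b
  setEdge M (inj₂ p) (inj₁ a) b = setCell M a p b
  setEdge M (inj₁ _) (inj₁ _) b = M
  setEdge M (inj₂ _) (inj₂ _) b = M

  setEdge-hit : ∀ {K : ESet nA nP} M x y b → KEdge K x y → inM (setEdge M x y b) x y ≡ b
  setEdge-hit M (inj₁ a) (inj₂ p) b _ = update-hit M a p b
  setEdge-hit M (inj₂ p) (inj₁ a) b _ = update-hit M a p b

  SameEdge : Vertex nA nP → Vertex nA nP → Vertex nA nP → Vertex nA nP → Set
  SameEdge x y s t = (s ≡ x × t ≡ y) ⊎ (s ≡ y × t ≡ x)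

  sameEdge? : ∀ x y s t → Dec (SameEdge x y s t)
  sameEdge? x y s t with s ≟V x | t ≟V y | s ≟V y | t ≟V x
  ... | yes sx | yes ty | _ | _         = yes (inj₁ (sx , ty))
  ... | _ | _ | yes sy | yes tx         = yes (inj₂ (sy , tx))
  ... | no sx | _ | no sy | _           = no λ { (inj₁ (e , _)) → sx e ; (inj₂ (e , _)) → sy e }
  ... | no sx | _ | yes _ | no tx       = no λ { (inj₁ (e , _)) → sx e ; (inj₂ (_ , e)) → tx e }
  ... | yes _ | no ty | no sy | _       = no λ { (inj₁ (_ , e)) → ty e ; (inj₂ (e , _)) → sy e }
  ... | yes _ | no ty | yes _ | no tx   = no λ { (inj₁ (_ , e)) → ty e ; (inj₂ (_ , e)) → tx e }

  setEdge-miss : ∀ M x y b s t → ¬ SameEdge x y s t → inM (setEdge M x y b) s t ≡ inM M s t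
  setEdge-miss M (inj₁ a) (inj₂ p) b (inj₁ a′) (inj₂ p′) off =
    update-miss M a p b a′ p′ λ { (refl , refl) → off (inj₁ (refl , refl)) }
  setEdge-miss M (inj₁ a) (inj₂ p) b (inj₂ p′) (inj₁ a′) off =
    update-miss M a p b a′ p′ λ { (refl , refl) → off (inj₂ (refl , refl)) }
  setEdge-miss M (inj₂ p) (inj₁ a) b (inj₁ a′) (inj₂ p′) off =
    update-miss M a p b a′ p′ λ { (refl , refl) → off (inj₂ (refl , refl)) }
  setEdge-miss M (inj₂ p) (inj₁ a) b (inj₂ p′) (inj₁ a′) off =
    update-miss M a p b a′ p′ λ { (refl , refl) → off (inj₁ (refl , refl)) }
  setEdge-miss M (inj₁ _) (inj₂ _) b (inj₁ _) (inj₁ _) _ = refl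
  setEdge-miss M (inj₁ _) (inj₂ _) b (inj₂ _) (inj₂ _) _ = refl
  setEdge-miss M (inj₂ _) (inj₁ _) b (inj₁ _) (inj₁ _) _ = refl
  setEdge-miss M (inj₂ _) (inj₁ _) b (inj₂ _) (inj₂ _) _ = refl
  setEdge-miss M (inj₁ _) (inj₁ _) b s t _ = refl
  setEdge-miss M (inj₂ _) (inj₂ _) b s t _ = refl

  setEdge-same : ∀ {K : ESet nA nP} M x y b s t → KEdge K x y → SameEdge x y s t →
                 inM (setEdge M x y b) s t ≡ b
  setEdge-same M x y b s t xy (inj₁ (refl , refl)) = setEdge-hit M x y b xy
  setEdge-same M x y b s t xy (inj₂ (refl , refl)) =
    trans (inM-sym (setEdge M x y b) y x) (setEdge-hit M x y b xy)

  edgeCount-setCell : ∀ (φ : Fin nA → Fin nP → Bool → Bool) M a p b →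
    edgeCount (λ a′ p′ → φ a′ p′ (setCell M a p b a′ p′)) + bit (φ a p (M a p)) ≡
    edgeCount (λ a′ p′ → φ a′ p′ (M a′ p′)) + bit (φ a p b)
  edgeCount-setCell φ M a p b =
    subst (λ z → edgeCount (λ a′ p′ → φ a′ p′ (setCell M a p b a′ p′)) + bit (φ a p (M a p)) ≡
                 edgeCount (λ a′ p′ → φ a′ p′ (M a′ p′)) + bit (φ a p z))
      (update-hit M a p b)
      (edgeCount-point _ _ a p (λ a′ p′ off → cong (φ a′ p′) (update-miss M a p b a′ p′ off)))

  edgeCount-setEdge : ∀ {K : ESet nA nP} M x y b → KEdge K x y →
    edgeCount (setEdge M x y b) + bit (inM M x y) ≡ edgeCount M + bit b
  edgeCount-setEdge M (inj₁ a) (inj₂ p) b _ = edgeCount-setCell (λ _ _ c → c) M a p b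
  edgeCount-setEdge M (inj₂ p) (inj₁ a) b _ = edgeCount-setCell (λ _ _ c → c) M a p b

  -- The number of edges of X outside Z; it measures how far X is from Z and decreases
  -- when X is moved towards Z along an alternating path.
  excess : EdgeSel nA nP → EdgeSel nA nP → ℕ
  excess Z X = edgeCount (λ a p → X a p ∧ not (Z a p))

  excess-setEdge : ∀ {K : ESet nA nP} Z M x y b → KEdge K x y →
    excess Z (setEdge M x y b) + bit (inM M x y ∧ not (inM Z x y)) ≡ excess Z M + bit (b ∧ not (inM Z x y))
  excess-setEdge Z M (inj₁ a) (inj₂ p) b _ = edgeCount-setCell (λ a p c → c ∧ not (Z a p)) M a p b
  excess-setEdge Z M (inj₂ p) (inj₁ a) b _ = edgeCount-setCell (λ a p c → c ∧ not (Z a p)) M a p b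

unique-head∉ : ∀ {A : Set} {x : A} {xs} → Unique (x ∷ xs) → x ∉ xs
unique-head∉ (x≢xs ∷ _) = All¬⇒¬Any x≢xs

unique-tail : ∀ {A : Set} {x : A} {xs} → Unique (x ∷ xs) → Unique xs
unique-tail (_ ∷ u) = u

tail-away : ∀ {A : Set} {u w₁ : A} {ws} → Unique (u ∷ w₁ ∷ ws) → All (λ z → z ≢ u × z ≢ w₁) ws
tail-away distinct =
  All.zip (¬Any⇒All¬ _ (λ m → unique-head∉ distinct (there (Any.map sym m))) ,
           ¬Any⇒All¬ _ (λ m → unique-head∉ (unique-tail distinct) (Any.map sym m)))

endOf-∈ : ∀ {nA nP} (h : Vertex nA nP) t → endOf h t ∈ (h ∷ t)
endOf-∈ h [] = here refl
endOf-∈ h (w ∷ t) = there (endOf-∈ w t)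

isOdd : ℕ → Bool
isOdd zero = false
isOdd (suc n) = not (isOdd n)

module _ {nA nP : ℕ} {K : ESet nA nP} where

  AltFrom-transfer : ∀ (M M′ : EdgeSel nA nP) (P : Vertex nA nP → Set) →
    (∀ s t → P s → P t → inM M′ s t ≡ inM M s t) →
    ∀ b h t → All P (h ∷ t) → AltFrom K M b h t → AltFrom K M′ b h t
  AltFrom-transfer M M′ P agree b h [] _ _ = tt
  AltFrom-transfer M M′ P agree b h (w ∷ t) (ph ∷ pw ∷ ps) (hw , hw∈M , alt) =
    hw , trans (agree h w ph pw) hw∈M , AltFrom-transfer M M′ P agree (not b) w t (pw ∷ ps) alt

  -- Exchange at the start of an alternating path u, w₁, w₂ from a free vertex u: the matching
  -- edge {w₁,w₂} is replaced by {u,w₁}.  Afterwards w₂ is free and the rest of the path is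
  -- untouched, so the exchange can be iterated along the path.
  module Exchange (M : EdgeSel nA nP) (isM : IsSymMatching K M) (u w₁ w₂ : Vertex nA nP)
                  (u-free : Free M u) (uw₁ : KEdge K u w₁) (w₁w₂∈M : inM M w₁ w₂ ≡ true)
                  (u≢w₂ : u ≢ w₂) where
    M₀ = setEdge M w₁ w₂ false
    M′ = setEdge M₀ u w₁ true

    w₁w₂ : KEdge K w₁ w₂
    w₁w₂ = proj₁ isM w₁ w₂ w₁w₂∈M
    u≢w₁ : u ≢ w₁
    u≢w₁ = KEdge-≢ u w₁ uw₁
    w₁≢w₂ : w₁ ≢ w₂
    w₁≢w₂ = KEdge-≢ w₁ w₂ w₁w₂

    classify : ∀ s t → inM M′ s t ≡ true → SameEdge u w₁ s t ⊎ (inM M s t ≡ true × ¬ SameEdge w₁ w₂ s t)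
    classify s t st∈M′ with sameEdge? u w₁ s t
    ... | yes new = inj₁ new
    ... | no not-new with sameEdge? w₁ w₂ s t
    ... | yes old
      with () ← trans (sym st∈M′) (trans (setEdge-miss M₀ u w₁ true s t not-new)
                                         (setEdge-same {K = K} M w₁ w₂ false s t w₁w₂ old))
    ... | no not-old = inj₂ (trans (sym (untouched s t not-new not-old)) st∈M′ , not-old)
      where
      untouched : ∀ s t → ¬ SameEdge u w₁ s t → ¬ SameEdge w₁ w₂ s t → inM M′ s t ≡ inM M s t
      untouched s t n₁ n₂ = trans (setEdge-miss M₀ u w₁ true s t n₁) (setEdge-miss M w₁ w₂ false s t n₂)

    agree : ∀ s t → (s ≢ u × s ≢ w₁) → (t ≢ u × t ≢ w₁) → inM M′ s t ≡ inM M s t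
    agree s t (s≢u , s≢w₁) (_ , t≢w₁) =
      trans (setEdge-miss M₀ u w₁ true s t λ { (inj₁ (e , _)) → s≢u e ; (inj₂ (e , _)) → s≢w₁ e })
            (setEdge-miss M w₁ w₂ false s t λ { (inj₁ (e , _)) → s≢w₁ e ; (inj₂ (_ , e)) → t≢w₁ e })

    uw₁∈M′ : inM M′ u w₁ ≡ true
    uw₁∈M′ = setEdge-hit {K = K} M₀ u w₁ true uw₁

    -- M′ is again a matching: w₁ lost its old partner w₂, and u was free.
    isM′ : IsSymMatching K M′
    isM′ = inK , unique
      where
      inK : ∀ s t → inM M′ s t ≡ true → KEdge K s t
      inK s t st with classify s t st
      ... | inj₁ (inj₁ (refl , refl)) = uw₁
      ... | inj₁ (inj₂ (refl , refl)) = KEdge-sym u w₁ uw₁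
      ... | inj₂ (st∈M , _) = proj₁ isM s t st∈M
      unique : ∀ s t t′ → inM M′ s t ≡ true → inM M′ s t′ ≡ true → t ≡ t′
      unique s t t′ st st′ with classify s t st | classify s t′ st′
      ... | inj₁ (inj₁ (refl , refl)) | inj₁ (inj₁ (_ , refl)) = refl
      ... | inj₁ (inj₂ (refl , refl)) | inj₁ (inj₂ (_ , refl)) = refl
      ... | inj₁ (inj₁ (refl , refl)) | inj₁ (inj₂ (e , _)) = ⊥-elim (u≢w₁ e)
      ... | inj₁ (inj₂ (refl , refl)) | inj₁ (inj₁ (e , _)) = ⊥-elim (u≢w₁ (sym e))
      ... | inj₁ (inj₁ (refl , refl)) | inj₂ (ut′ , _) = ⊥-elim (covered-free-⊥ M u (t′ , ut′) u-free)
      ... | inj₂ (ut , _) | inj₁ (inj₁ (refl , refl)) = ⊥-elim (covered-free-⊥ M u (t , ut) u-free)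
      ... | inj₁ (inj₂ (refl , refl)) | inj₂ (w₁t′ , old) =
        ⊥-elim (old (inj₁ (refl , sym (proj₂ isM w₁ w₂ t′ w₁w₂∈M w₁t′))))
      ... | inj₂ (w₁t , old) | inj₁ (inj₂ (refl , refl)) =
        ⊥-elim (old (inj₁ (refl , sym (proj₂ isM w₁ w₂ t w₁w₂∈M w₁t))))
      ... | inj₂ (st∈M , _) | inj₂ (st′∈M , _) = proj₂ isM s t t′ st∈M st′∈M

    uw₁∉M₀ : inM M₀ u w₁ ≡ false
    uw₁∉M₀ = trans (setEdge-miss M w₁ w₂ false u w₁ λ { (inj₁ (e , _)) → u≢w₁ e ; (inj₂ (e , _)) → u≢w₂ e })
                   (u-free w₁)

    size-same : edgeCount M′ ≡ edgeCount M
    size-same = +-cancelʳ-≡ 0 _ _ (trans add remove)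
      where
      add : edgeCount M′ + 0 ≡ edgeCount M₀ + 1
      add = subst (λ z → edgeCount M′ + bit z ≡ edgeCount M₀ + 1) uw₁∉M₀
              (edgeCount-setEdge {K = K} M₀ u w₁ true uw₁)
      remove : edgeCount M₀ + 1 ≡ edgeCount M + 0
      remove = subst (λ z → edgeCount M₀ + bit z ≡ edgeCount M + 0) w₁w₂∈M
                 (edgeCount-setEdge {K = K} M w₁ w₂ false w₁w₂)

    excess-drops : ∀ Z → inM Z u w₁ ≡ true → inM Z w₁ w₂ ≡ false → excess Z M′ + 1 ≡ excess Z M
    excess-drops Z uw₁∈Z w₁w₂∉Z = trans (cong (_+ 1) add) remove
      where
      add : excess Z M′ ≡ excess Z M₀
      add = +-cancelʳ-≡ 0 _ _ (subst₂ (λ m z → excess Z M′ + bit (m ∧ not z) ≡ excess Z M₀ + bit (true ∧ not z))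
              uw₁∉M₀ uw₁∈Z (excess-setEdge {K = K} Z M₀ u w₁ true uw₁))
      remove : excess Z M₀ + 1 ≡ excess Z M
      remove = trans (subst₂ (λ m z → excess Z M₀ + bit (m ∧ not z) ≡ excess Z M + bit (false ∧ not z))
                 w₁w₂∈M w₁w₂∉Z (excess-setEdge {K = K} Z M w₁ w₂ false w₁w₂)) (+-identityʳ _)

    w₂-free : Free M′ w₂
    w₂-free t = ¬-not λ w₂t → impossible (classify w₂ t w₂t)
      where
      impossible : SameEdge u w₁ w₂ t ⊎ (inM M w₂ t ≡ true × ¬ SameEdge w₁ w₂ w₂ t) → ⊥
      impossible (inj₁ (inj₁ (e , _))) = u≢w₂ (sym e)
      impossible (inj₁ (inj₂ (e , _))) = w₁≢w₂ (sym e)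
      impossible (inj₂ (w₂t , old)) =
        old (inj₂ (refl , proj₂ isM w₂ t w₁ w₂t (trans (inM-sym M w₂ w₁) w₁w₂∈M)))

    free-preserved : ∀ v → Free M v → v ≢ u → v ≢ w₁ → Free M′ v
    free-preserved v v-free v≢u v≢w₁ t = ¬-not λ vt → impossible (classify v t vt)
      where
      impossible : SameEdge u w₁ v t ⊎ (inM M v t ≡ true × ¬ SameEdge w₁ w₂ v t) → ⊥
      impossible (inj₁ (inj₁ (e , _))) = v≢u e
      impossible (inj₁ (inj₂ (e , _))) = v≢w₁ e
      impossible (inj₂ (vt , _)) = covered-free-⊥ M v (t , vt) v-free

    covered-preserved : ∀ s → Covered M s → s ≢ w₂ → Covered M′ s
    covered-preserved s (t , st) s≢w₂ with s ≟V u | s ≟V w₁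
    ... | yes refl | _ = w₁ , uw₁∈M′
    ... | no _ | yes refl = u , trans (inM-sym M′ w₁ u) uw₁∈M′
    ... | no s≢u | no s≢w₁ =
      t , trans (setEdge-miss M₀ u w₁ true s t λ { (inj₁ (e , _)) → s≢u e ; (inj₂ (e , _)) → s≢w₁ e })
                (trans (setEdge-miss M w₁ w₂ false s t λ { (inj₁ (e , _)) → s≢w₁ e ; (inj₂ (e , _)) → s≢w₂ e })
                       st)

  module AddEdge (M : EdgeSel nA nP) (isM : IsSymMatching K M) (u w : Vertex nA nP)
                 (u-free : Free M u) (w-free : Free M w) (uw : KEdge K u w) where
    M′ = setEdge M u w true

    classify : ∀ s t → inM M′ s t ≡ true → SameEdge u w s t ⊎ inM M s t ≡ true
    classify s t st with sameEdge? u w s t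
    ... | yes new = inj₁ new
    ... | no not-new = inj₂ (trans (sym (setEdge-miss M u w true s t not-new)) st)

    isM′ : IsSymMatching K M′
    isM′ = inK , unique
      where
      u≢w = KEdge-≢ u w uw
      inK : ∀ s t → inM M′ s t ≡ true → KEdge K s t
      inK s t st with classify s t st
      ... | inj₁ (inj₁ (refl , refl)) = uw
      ... | inj₁ (inj₂ (refl , refl)) = KEdge-sym u w uw
      ... | inj₂ st∈M = proj₁ isM s t st∈M
      unique : ∀ s t t′ → inM M′ s t ≡ true → inM M′ s t′ ≡ true → t ≡ t′
      unique s t t′ st st′ with classify s t st | classify s t′ st′
      ... | inj₁ (inj₁ (refl , refl)) | inj₁ (inj₁ (_ , refl)) = refl
      ... | inj₁ (inj₂ (refl , refl)) | inj₁ (inj₂ (_ , refl)) = refl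
      ... | inj₁ (inj₁ (refl , refl)) | inj₁ (inj₂ (e , _)) = ⊥-elim (u≢w e)
      ... | inj₁ (inj₂ (refl , refl)) | inj₁ (inj₁ (e , _)) = ⊥-elim (u≢w (sym e))
      ... | inj₁ (inj₁ (refl , refl)) | inj₂ ut′ = ⊥-elim (covered-free-⊥ M u (t′ , ut′) u-free)
      ... | inj₁ (inj₂ (refl , refl)) | inj₂ wt′ = ⊥-elim (covered-free-⊥ M w (t′ , wt′) w-free)
      ... | inj₂ ut | inj₁ (inj₁ (refl , refl)) = ⊥-elim (covered-free-⊥ M u (t , ut) u-free)
      ... | inj₂ wt | inj₁ (inj₂ (refl , refl)) = ⊥-elim (covered-free-⊥ M w (t , wt) w-free)
      ... | inj₂ st∈M | inj₂ st′∈M = proj₂ isM s t t′ st∈M st′∈M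

    size-suc : edgeCount M′ ≡ suc (edgeCount M)
    size-suc = trans (sym (+-identityʳ _))
      (trans (subst (λ z → edgeCount M′ + bit z ≡ edgeCount M + 1) (u-free w)
                    (edgeCount-setEdge {K = K} M u w true uw))
             (+-comm (edgeCount M) 1))

    covered-preserved : ∀ s → Covered M s → Covered M′ s
    covered-preserved s (t , st) = t , trans (setEdge-miss M u w true s t untouched) st
      where
      untouched : ¬ SameEdge u w s t
      untouched (inj₁ (refl , _)) = covered-free-⊥ M u (t , st) u-free
      untouched (inj₂ (refl , _)) = covered-free-⊥ M w (t , st) w-free

    u-covered : Covered M′ u
    u-covered = w , setEdge-hit {K = K} M u w true uw

  record Augmentation (M : EdgeSel nA nP) (u : Vertex nA nP) : Set where
    field
      matching          : EdgeSel nA nP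
      isMatching        : IsSymMatching K matching
      size-suc          : edgeCount matching ≡ suc (edgeCount M)
      covered-preserved : ∀ s → Covered M s → Covered matching s
      start-covered     : Covered matching u

  augment : ∀ M → IsSymMatching K M → ∀ u ws → Free M u → AltFrom K M false u ws →
            Unique (u ∷ ws) → isOdd (length ws) ≡ true → Free M (endOf u ws) → Augmentation M u
  augment M isM u (w ∷ []) u-free (uw , _ , _) _ _ w-free =
    record { matching = M′ ; isMatching = isM′ ; size-suc = size-suc
           ; covered-preserved = covered-preserved ; start-covered = u-covered }
    where open AddEdge M isM u w u-free w-free uw
  augment M isM u (w₁ ∷ w₂ ∷ ws) u-free (uw₁ , _ , _ , w₁w₂∈M , alt) distinct odd end-free =
    record { matching = Aug.matching ; isMatching = Aug.isMatching
           ; size-suc = trans Aug.size-suc (cong suc size-same)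
           ; covered-preserved = covered ; start-covered = Aug.covered-preserved u (w₁ , uw₁∈M′) }
    where
    away : All (λ z → z ≢ u × z ≢ w₁) (w₂ ∷ ws)
    away = tail-away distinct
    open Exchange M isM u w₁ w₂ u-free uw₁ w₁w₂∈M (λ e → proj₁ (All.head away) (sym e))
    end-away = All.lookup away (endOf-∈ w₂ ws)
    Aug = augment M′ isM′ w₂ ws w₂-free
            (AltFrom-transfer M M′ (λ z → z ≢ u × z ≢ w₁) agree false w₂ ws away alt)
            (unique-tail (unique-tail distinct)) (trans (sym (not-involutive _)) odd)
            (free-preserved (endOf w₂ ws) end-free (proj₁ end-away) (proj₂ end-away))
    module Aug = Augmentation Aug
    covered : ∀ s → Covered M s → Covered Aug.matching s
    covered s s-cov with s ≟V w₂
    ... | yes refl = Aug.start-covered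
    ... | no s≢w₂ = Aug.covered-preserved s (covered-preserved s s-cov s≢w₂)

  record EvenShift (M : EdgeSel nA nP) (u : Vertex nA nP) (ws : List (Vertex nA nP)) : Set where
    field
      matching        : EdgeSel nA nP
      isMatching      : IsSymMatching K matching
      size-same       : edgeCount matching ≡ edgeCount M
      end-free        : Free matching (endOf u ws)
      closer          : ∀ Z → AltFrom K Z true u ws → excess Z matching ≤ excess Z M
      strictly-closer : ∀ Z → AltFrom K Z true u ws → ws ≢ [] → excess Z matching < excess Z M

  shift-even : ∀ M → IsSymMatching K M → ∀ u ws → Free M u → AltFrom K M false u ws →
               Unique (u ∷ ws) → isOdd (length ws) ≡ false → EvenShift M u ws
  shift-even M isM u [] u-free _ _ _ =
    record { matching = M ; isMatching = isM ; size-same = refl ; end-free = u-free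
           ; closer = λ _ _ → ≤-refl ; strictly-closer = λ _ _ nonempty → ⊥-elim (nonempty refl) }
  shift-even M isM u (w₁ ∷ w₂ ∷ ws) u-free (uw₁ , _ , _ , w₁w₂∈M , alt) distinct even =
    record { matching = Rest.matching ; isMatching = Rest.isMatching
           ; size-same = trans Rest.size-same size-same ; end-free = Rest.end-free
           ; closer = λ Z alt-Z → <⇒≤ (strict Z alt-Z) ; strictly-closer = λ Z alt-Z _ → strict Z alt-Z }
    where
    away : All (λ z → z ≢ u × z ≢ w₁) (w₂ ∷ ws)
    away = tail-away distinct
    open Exchange M isM u w₁ w₂ u-free uw₁ w₁w₂∈M (λ e → proj₁ (All.head away) (sym e))
    Rest = shift-even M′ isM′ w₂ ws w₂-free
             (AltFrom-transfer M M′ (λ z → z ≢ u × z ≢ w₁) agree false w₂ ws away alt)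
             (unique-tail (unique-tail distinct)) (trans (sym (not-involutive _)) even)
    module Rest = EvenShift Rest
    strict : ∀ Z → AltFrom K Z true u (w₁ ∷ w₂ ∷ ws) → excess Z Rest.matching < excess Z M
    strict Z (_ , uw₁∈Z , _ , w₁w₂∉Z , alt-Z) =
      subst (excess Z Rest.matching <_) (trans (+-comm 1 _) (excess-drops Z uw₁∈Z w₁w₂∉Z))
            (s≤s (Rest.closer Z alt-Z))

-- Berge's theorem: a matching is maximum iff it has no augmenting path.

unique-length≤ : ∀ {A : Set} (xs ys : List A) → Unique xs → (∀ {x} → x ∈ xs → x ∈ ys) →
                 length xs ≤ length ys
unique-length≤ [] ys _ _ = z≤n
unique-length≤ (x ∷ xs) ys (x∉xs ∷ distinct) xs⊆ys with ∈-∃++ (xs⊆ys (here refl))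
... | ys₁ , ys₂ , refl =
  subst (suc (length xs) ≤_) (sym (length-++-sucʳ ys₁ x ys₂))
        (s≤s (unique-length≤ xs (ys₁ ++ ys₂) distinct xs⊆ys₁ys₂))
  where
  xs⊆ys₁ys₂ : ∀ {y} → y ∈ xs → y ∈ ys₁ ++ ys₂
  xs⊆ys₁ys₂ y∈xs with ∈-++⁻ ys₁ (xs⊆ys (there y∈xs))
  ... | inj₁ y∈ys₁ = ∈-++⁺ˡ y∈ys₁
  ... | inj₂ (here refl) = ⊥-elim (All¬⇒¬Any x∉xs y∈xs)
  ... | inj₂ (there y∈ys₂) = ∈-++⁺ʳ ys₁ y∈ys₂

-- Every list of distinct vertices has at most nA + nP elements; this bounds the length of
-- the walk below.
module _ {nA nP : ℕ} where
  allVertices : List (Vertex nA nP)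
  allVertices = map inj₁ (allFin nA) ++ map inj₂ (allFin nP)

  unique-vertices≤ : ∀ (xs : List (Vertex nA nP)) → Unique xs → length xs ≤ nA + nP
  unique-vertices≤ xs distinct =
    subst (length xs ≤_) total (unique-length≤ xs allVertices distinct (λ {x} _ → ∈-allVertices x))
    where
    ∈-allVertices : ∀ x → x ∈ allVertices
    ∈-allVertices (inj₁ a) = ∈-++⁺ˡ (∈-map⁺ inj₁ (∈-allFin a))
    ∈-allVertices (inj₂ p) = ∈-++⁺ʳ (map inj₁ (allFin nA)) (∈-map⁺ inj₂ (∈-allFin p))
    total : length allVertices ≡ nA + nP
    total = trans (length-++ (map inj₁ (allFin nA)))
      (cong₂ _+_ (trans (length-map inj₁ (allFin nA)) (length-tabulate {n = nA} (λ i → i)))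
                 (trans (length-map inj₂ (allFin nP)) (length-tabulate {n = nP} (λ i → i))))

-- The component of the symmetric difference of two matchings A and B containing a vertex v
-- that is free in A but covered by B is a path; following it from v to its other end e
-- yields an alternating path from e to v which starts with a non-edge of the matching in
-- which e is free.
module SymmetricDifference {nA nP : ℕ} (K : ESet nA nP) (A B : EdgeSel nA nP)
    (isA : IsSymMatching K A) (isB : IsSymMatching K B) (v : Vertex nA nP) where

  -- the matching in which the next step of the walk must be taken
  sel : Bool → EdgeSel nA nP
  sel true = A
  sel false = B

  isSel : ∀ c → IsSymMatching K (sel c)
  isSel true = isA
  isSel false = isB

  InEither : Vertex nA nP → Vertex nA nP → Set
  InEither y z = inM A y z ≡ true ⊎ inM B y z ≡ true

  toSel : ∀ c y z → InEither y z → inM (sel c) y z ≡ true ⊎ inM (sel (not c)) y z ≡ true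
  toSel true y z e = e
  toSel false y z (inj₁ e) = inj₂ e
  toSel false y z (inj₂ e) = inj₁ e

  fromSel : ∀ c y z → inM (sel c) y z ≡ true → InEither y z
  fromSel true y z e = inj₁ e
  fromSel false y z e = inj₂ e

  EndPath : Set
  EndPath = ∃ λ c → ∃ λ e → ∃ λ t → Unique (e ∷ t) × endOf e t ≡ v × Free (sel c) e ×
            isOdd (length t) ≡ c × AltFrom K (sel c) false e t × AltFrom K (sel (not c)) true e t

  Closed : Vertex nA nP → Vertex nA nP → List (Vertex nA nP) → Set
  Closed h prev rest = ∀ y → y ∈ (prev ∷ rest) → ∀ z → InEither y z → z ∈ (h ∷ prev ∷ rest)

  OnlyPrev : Vertex nA nP → Vertex nA nP → List (Vertex nA nP) → Set
  OnlyPrev h prev rest = ∀ y → y ∈ (prev ∷ rest) → InEither y h → y ≡ prev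

  module Step (c : Bool) (h prev : Vertex nA nP) (rest : List (Vertex nA nP))
      (alt : AltFrom K (sel c) false h (prev ∷ rest)) (alt′ : AltFrom K (sel (not c)) true h (prev ∷ rest))
      (closed : Closed h prev rest) (only-prev : OnlyPrev h prev rest)
      (x : Vertex nA nP) (hx : inM (sel c) h x ≡ true) where
    path : List (Vertex nA nP)
    path = h ∷ prev ∷ rest
    hprev∉sel : inM (sel c) h prev ≡ false
    hprev∉sel = proj₁ (proj₂ alt)
    hprev∈other : inM (sel (not c)) h prev ≡ true
    hprev∈other = proj₁ (proj₂ alt′)

    x∉ : x ∉ path
    x∉ (here e) = matched-≢ (isSel c) h x hx (sym e)
    x∉ (there m) with only-prev x m (fromSel c x h (trans (inM-sym (sel c) x h) hx))
    ... | refl with () ← trans (sym hx) hprev∉sel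

    xh : KEdge K x h
    xh = KEdge-sym h x (proj₁ (isSel c) h x hx)

    alt-x : AltFrom K (sel (not c)) false x path
    alt-x = xh , xh∉other , alt′
      where
      xh∉other : inM (sel (not c)) x h ≡ false
      xh∉other = ¬-not λ e → x∉ (there (here (sym (proj₂ (isSel (not c)) h prev x hprev∈other
                                                     (trans (inM-sym (sel (not c)) h x) e)))))

    alt′-x : AltFrom K (sel (not (not c))) true x path
    alt′-x = subst (λ b → AltFrom K (sel b) true x path) (sym (not-involutive c))
                   (xh , trans (inM-sym (sel c) x h) hx , alt)

    closed-x : Closed x h (prev ∷ rest)
    closed-x y (here refl) z yz with toSel c h z yz
    ... | inj₁ in-sel = here (proj₂ (isSel c) h z x in-sel hx)
    ... | inj₂ in-other = there (there (here (proj₂ (isSel (not c)) h z prev in-other hprev∈other)))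
    closed-x y (there m) z yz = there (closed y m z yz)

    only-h : OnlyPrev x h (prev ∷ rest)
    only-h y (here refl) _ = refl
    only-h y (there m) yx = ⊥-elim (x∉ (closed y m x yx))

  -- Walk until the current end is free in the matching to be followed.  The fuel bounds the
  -- number of steps, since the path has distinct vertices.
  extend : ∀ (fuel : ℕ) (c : Bool) (h prev : Vertex nA nP) (rest : List (Vertex nA nP)) →
    Unique (h ∷ prev ∷ rest) → endOf h (prev ∷ rest) ≡ v →
    AltFrom K (sel c) false h (prev ∷ rest) → AltFrom K (sel (not c)) true h (prev ∷ rest) →
    isOdd (length (prev ∷ rest)) ≡ c → Closed h prev rest → OnlyPrev h prev rest →
    nA + nP < length (h ∷ prev ∷ rest) + fuel → EndPath
  extend fuel c h prev rest distinct ends alt alt′ parity closed only-prev bound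
    with covered? (sel c) h
  ... | inj₂ h-free = c , h , prev ∷ rest , distinct , ends , h-free , parity , alt , alt′
  ... | inj₁ (x , hx) = continue fuel bound
    where
    open Step c h prev rest alt alt′ closed only-prev x hx
    continue : ∀ f → nA + nP < length path + f → EndPath
    continue zero bound = ⊥-elim (<⇒≱ (subst (nA + nP <_) (+-identityʳ _) bound)
                                        (unique-vertices≤ path distinct))
    continue (suc f) bound =
      extend f (not c) x h (prev ∷ rest) (¬Any⇒All¬ path x∉ ∷ distinct) ends alt-x alt′-x
        (cong not parity) closed-x only-h (subst (nA + nP <_) (+-suc (length path) f) bound)

  component-path : Free A v → Covered B v →
    ∃ λ e → ∃ λ t → Unique (e ∷ t) × endOf e t ≡ v ×
      ((Free A e × isOdd (length t) ≡ true × AltFrom K A false e t × AltFrom K B true e t) ⊎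
       (Free B e × isOdd (length t) ≡ false × AltFrom K B false e t × AltFrom K A true e t))
  component-path v-free (w , vw)
    with extend (nA + nP) true w v [] distinct refl altA altB refl closed only-v (s≤s (n≤1+n _))
    where
    wv : KEdge K w v
    wv = KEdge-sym v w (proj₁ isB v w vw)
    distinct : Unique (w ∷ v ∷ [])
    distinct = ((λ e → matched-≢ isB v w vw (sym e)) ∷ []) ∷ [] ∷ []
    altA : AltFrom K A false w (v ∷ [])
    altA = wv , trans (inM-sym A w v) (v-free w) , tt
    altB : AltFrom K B true w (v ∷ [])
    altB = wv , trans (inM-sym B w v) vw , tt
    closed : Closed w v []
    closed y (here refl) z (inj₁ vz) = ⊥-elim (covered-free-⊥ A v (z , vz) v-free)
    closed y (here refl) z (inj₂ vz) = here (proj₂ isB v z w vz vw)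
    only-v : OnlyPrev w v []
    only-v y (here refl) _ = refl
  ... | true  , e , t , U , ends , e-free , odd , alt , alt′ = e , t , U , ends , inj₁ (e-free , odd , alt , alt′)
  ... | false , e , t , U , ends , e-free , even , alt , alt′ = e , t , U , ends , inj₂ (e-free , even , alt , alt′)

module _ {nA nP : ℕ} (K : ESet nA nP) where

  size-≤-by-applicants : ∀ X Y → IsSymMatching K X → IsSymMatching K Y →
    (∀ a → Covered X (inj₁ a) → Covered Y (inj₁ a)) → edgeCount X ≤ edgeCount Y
  size-≤-by-applicants X Y isX isY covers =
    subst₂ _≤_ (sym (edgeCount≡Σᶠ X)) (sym (edgeCount≡Σᶠ Y)) (Σᶠ-mono row≤)
    where
    row≤ : ∀ a → Σᶠ (λ p → bit (X a p)) ≤ Σᶠ (λ p → bit (Y a p))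
    row≤ a with covered? X (inj₁ a)
    ... | inj₂ a-free = subst (_≤ _) (sym (Σᶠ-zero (λ p → cong bit (a-free (inj₂ p))))) z≤n
    ... | inj₁ a-cov with covers a a-cov
    ... | inj₂ p , ap∈Y =
      ≤-trans (Σᶠ-atMostOne (X a) (λ p q ap aq → inj₂-injective (proj₂ isX (inj₁ a) (inj₂ p) (inj₂ q) ap aq)))
              (subst (λ z → bit z ≤ Σᶠ (λ q → bit (Y a q))) ap∈Y (Σᶠ-≥ (λ q → bit (Y a q)) p))

  applicant-covered-free : ∀ X Y → IsSymMatching K X → IsSymMatching K Y → edgeCount Y < edgeCount X →
    ∃ λ a → Covered X (inj₁ a) × Free Y (inj₁ a)
  applicant-covered-free X Y isX isY Y<X
    with ¬∀⟶∃¬ nA (λ a → Covered X (inj₁ a) → Covered Y (inj₁ a)) decide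
           (λ covers → <⇒≱ Y<X (size-≤-by-applicants X Y isX isY covers))
    where
    decide : ∀ a → Dec (Covered X (inj₁ a) → Covered Y (inj₁ a))
    decide a with covered? X (inj₁ a) | covered? Y (inj₁ a)
    ... | _ | inj₁ in-Y = yes (λ _ → in-Y)
    ... | inj₂ free-X | _ = yes (λ in-X → ⊥-elim (covered-free-⊥ X (inj₁ a) in-X free-X))
    ... | inj₁ in-X | inj₂ free-Y = no (λ f → covered-free-⊥ Y (inj₁ a) (f in-X) free-Y)
  ... | a , ¬covers with covered? X (inj₁ a) | covered? Y (inj₁ a)
  ... | _ | inj₁ in-Y = ⊥-elim (¬covers (λ _ → in-Y))
  ... | inj₂ free-X | _ = ⊥-elim (¬covers (λ in-X → ⊥-elim (covered-free-⊥ X (inj₁ a) in-X free-X)))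
  ... | inj₁ in-X | inj₂ free-Y = a , in-X , free-Y

  AugmentingPath : EdgeSel nA nP → Set
  AugmentingPath Y = ∃ λ e → ∃ λ t → Unique (e ∷ t) × Free Y e × Free Y (endOf e t) ×
                     AltFrom K Y false e t × isOdd (length t) ≡ true

  -- The symmetric
  -- difference component through an X-covered, Y-free applicant is either augmenting for Y, or
  -- an even path along which X can be shifted towards Y; the excess of X over Y decreases.
  berge : ∀ Y X → IsSymMatching K Y → IsSymMatching K X → edgeCount Y < edgeCount X → AugmentingPath Y
  berge Y X isY isX Y<X = go (suc (excess Y X)) X isX Y<X ≤-refl
    where
    go : ∀ n X → IsSymMatching K X → edgeCount Y < edgeCount X → excess Y X < n → AugmentingPath Y
    go (suc n) X isX Y<X bound with applicant-covered-free X Y isX isY Y<X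
    ... | a , a-cov , a-free with SymmetricDifference.component-path K Y X isY isX (inj₁ a) a-free a-cov
    ... | e , t , U , ends , inj₁ (e-free , odd , altY , _) =
      e , t , U , e-free , subst (Free Y) (sym ends) a-free , altY , odd
    ... | e , t , U , ends , inj₂ (e-free , even , altX , altY) =
      go n S.matching S.isMatching (subst (edgeCount Y <_) (sym S.size-same) Y<X)
         (≤-trans (S.strictly-closer Y altY nonempty) (≤-pred bound))
      where
      module S = EvenShift (shift-even {K = K} X isX e t e-free altX U even)
      nonempty : t ≢ []
      nonempty refl = covered-free-⊥ X e (subst (Covered X) (sym ends) a-cov) e-free

  maximum-no-augmenting : ∀ X → IsSymMatching K X →
    (∀ N → IsMatching AllV K N → size N ≤ size X) → AugmentingPath X → ⊥
  maximum-no-augmenting X isX maximal (e , t , U , e-free , end-free , alt , odd) =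
    <⇒≱ (subst (edgeCount X <_) (sym Aug.size-suc) ≤-refl) (maximal Aug.matching (toIsMatching Aug.isMatching))
    where module Aug = Augmentation (augment {K = K} X isX e t e-free alt U odd end-free)

-- The even / odd / unreachable decomposition of a bipartite graph (Gallai–Edmonds) and its
-- independence of the chosen maximum matching.

%2≡bit-isOdd : ∀ n → n % 2 ≡ bit (isOdd n)
%2≡bit-isOdd zero = refl
%2≡bit-isOdd (suc zero) = refl
%2≡bit-isOdd (suc (suc n)) = begin
  (2 + n) % 2         ≡⟨ cong (_% 2) (+-comm 2 n) ⟩
  (n + 2) % 2         ≡⟨ [m+n]%n≡m%n n 2 ⟩
  n % 2               ≡⟨ %2≡bit-isOdd n ⟩
  bit (isOdd n)       ≡⟨ cong bit (not-involutive (isOdd n)) ⟨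
  bit (isOdd (2 + n)) ∎
  where open ≡-Reasoning

even-isOdd : ∀ n → n % 2 ≡ 0 → isOdd n ≡ false
even-isOdd n n%2 with isOdd n | %2≡bit-isOdd n
... | false | _ = refl
... | true | e with () ← trans (sym e) n%2

odd-isOdd : ∀ n → n % 2 ≡ 1 → isOdd n ≡ true
odd-isOdd n n%2 with isOdd n | %2≡bit-isOdd n
... | true | _ = refl
... | false | e with () ← trans (sym e) n%2

xor-not : ∀ b p → not b xor p ≡ b xor not p
xor-not b p = trans (sym (not-distribˡ-xor b p)) (not-distribʳ-xor b p)

xor≡not⇒true : ∀ b p → b xor p ≡ not b → p ≡ true
xor≡not⇒true true true _ = refl
xor≡not⇒true false true _ = refl

xor≡id⇒false : ∀ b p → b xor p ≡ b → p ≡ false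
xor≡id⇒false true false _ = refl
xor≡id⇒false false false _ = refl

not-xor-true : ∀ b → not (b xor true) ≡ b
not-xor-true true = refl
not-xor-true false = refl

module _ {nA nP : ℕ} (K : ESet nA nP) where
  open DecMembership (_≟V_ {nA} {nP}) using (_∈?_)

  EvenVia OddVia : EdgeSel nA nP → Vertex nA nP → Set
  EvenVia M v = ∃ λ u → ∃ λ ws → Free M u × Unique (u ∷ ws) × endOf u ws ≡ v ×
                AltFrom K M false u ws × isOdd (length ws) ≡ false
  OddVia M v = ∃ λ u → ∃ λ ws → Free M u × Unique (u ∷ ws) × endOf u ws ≡ v ×
               AltFrom K M false u ws × isOdd (length ws) ≡ true

  starts-unmatched : ∀ M b u ws → Free M u → AltFrom K M b u ws → AltFrom K M false u ws
  starts-unmatched M b u [] _ _ = tt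
  starts-unmatched M b u (w ∷ ws) u-free (uw , uw∈M , alt) with trans (sym uw∈M) (u-free w)
  ... | refl = uw , uw∈M , alt

  EvenWrt→EvenVia : ∀ M v → EvenWrt AllV K M v → EvenVia M v
  EvenWrt→EvenVia M v (u , ws , u-free , (U , ends , (b , alt)) , even) =
    u , ws , free , U , ends , starts-unmatched M b u ws free alt , even-isOdd (length ws) even
    where free = unmatched⇒free u u-free

  EvenVia→EvenWrt : ∀ M v → EvenVia M v → EvenWrt AllV K M v
  EvenVia→EvenWrt M v (u , ws , u-free , U , ends , alt , even) =
    u , ws , free⇒unmatched u u-free , (U , ends , (false , alt)) ,
    trans (%2≡bit-isOdd (length ws)) (cong bit even)

  OddWrt→OddVia : ∀ M v → OddWrt AllV K M v → OddVia M v
  OddWrt→OddVia M v (u , ws , u-free , (U , ends , (b , alt)) , odd) =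
    u , ws , free , U , ends , starts-unmatched M b u ws free alt , odd-isOdd (length ws) odd
    where free = unmatched⇒free u u-free

  OddVia→OddWrt : ∀ M v → OddVia M v → OddWrt AllV K M v
  OddVia→OddWrt M v (u , ws , u-free , U , ends , alt , odd) =
    u , ws , free⇒unmatched u u-free , (U , ends , (false , alt)) ,
    trans (%2≡bit-isOdd (length ws)) (cong bit odd)

  free-even : ∀ M v → Free M v → EvenVia M v
  free-even M v v-free = v , [] , v-free , [] ∷ [] , refl , tt , refl

  -- Sides alternate along a path, so the parity of a path is determined by its endpoints.
  side-endOf : ∀ M b u ws → AltFrom K M b u ws → side (endOf u ws) ≡ side u xor isOdd (length ws)
  side-endOf M b u [] _ = sym (xor-identityʳ (side u))
  side-endOf M b u (w ∷ ws) (uw , _ , alt) = begin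
    side (endOf w ws)                ≡⟨ side-endOf M (not b) w ws alt ⟩
    side w xor isOdd (length ws)     ≡⟨ cong (_xor isOdd (length ws)) (KEdge-side {K = K} u w uw) ⟩
    not (side u) xor isOdd (length ws) ≡⟨ xor-not (side u) _ ⟩
    side u xor isOdd (length (w ∷ ws)) ∎
    where open ≡-Reasoning

  prefix : ∀ M b u ws o → o ∈ (u ∷ ws) → Unique (u ∷ ws) → AltFrom K M b u ws →
    ∃ λ ws₁ → Unique (u ∷ ws₁) × endOf u ws₁ ≡ o × AltFrom K M b u ws₁ ×
              (∀ {z} → z ∈ (u ∷ ws₁) → z ∈ (u ∷ ws))
  prefix M b u ws o (here refl) U alt = [] , [] ∷ [] , refl , tt , λ { (here e) → here e }
  prefix M b u (w ∷ ws) o (there o∈) U (uw , uw∈M , alt)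
    with prefix M (not b) w ws o o∈ (unique-tail U) alt
  ... | ws₁ , U₁ , ends , alt₁ , sub =
    w ∷ ws₁ , ¬Any⇒All¬ (w ∷ ws₁) (λ u∈ → unique-head∉ U (sub u∈)) ∷ U₁ , ends , (uw , uw∈M , alt₁) ,
    λ { (here e) → here e ; (there z) → there (sub z) }

  snoc-alt : ∀ M b u ws o → AltFrom K M b u ws → KEdge K (endOf u ws) o →
    inM M (endOf u ws) o ≡ b xor isOdd (length ws) → AltFrom K M b u (ws ++ [ o ])
  snoc-alt M b u [] o _ uo uo∈M = uo , trans uo∈M (xor-identityʳ b) , tt
  snoc-alt M b u (w ∷ ws) o (uw , uw∈M , alt) last last∈M =
    uw , uw∈M , snoc-alt M (not b) w ws o alt last (trans last∈M (sym (xor-not b (isOdd (length ws)))))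

  snoc-unique : ∀ (xs : List (Vertex nA nP)) o → Unique xs → o ∉ xs → Unique (xs ++ [ o ])
  snoc-unique xs o U o∉ = Unique.++⁺ U ([] ∷ []) λ { (o∈ , here refl) → o∉ o∈ }

  snoc-endOf : ∀ (u : Vertex nA nP) ws o → endOf u (ws ++ [ o ]) ≡ o
  snoc-endOf u [] o = refl
  snoc-endOf u (w ∷ ws) o = snoc-endOf w ws o

  snoc-isOdd : ∀ (ws : List (Vertex nA nP)) o → isOdd (length (ws ++ [ o ])) ≡ not (isOdd (length ws))
  snoc-isOdd ws o = cong isOdd (trans (length-++ ws) (+-comm (length ws) 1))

  last-edge : ∀ M b u w ws → AltFrom K M b u (w ∷ ws) →
    ∃ λ pr → pr ∈ (u ∷ w ∷ ws) × KEdge K pr (endOf w ws) × inM M pr (endOf w ws) ≡ b xor isOdd (length ws)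
  last-edge M b u w [] (uw , uw∈M , _) = u , here refl , uw , trans uw∈M (sym (xor-identityʳ b))
  last-edge M b u w (w′ ∷ ws) (_ , _ , alt) with last-edge M (not b) w w′ ws alt
  ... | pr , pr∈ , last , last∈M = pr , there pr∈ , last , trans last∈M (xor-not b (isOdd (length ws)))

  even-end-partner : ∀ M → IsSymMatching K M → ∀ u ws o → Free M u → AltFrom K M false u ws →
    isOdd (length ws) ≡ false → o ∉ (u ∷ ws) → inM M (endOf u ws) o ≡ false
  even-end-partner M isM u [] o u-free _ _ _ = u-free o
  even-end-partner M isM u (w ∷ ws) o u-free alt even o∉ with last-edge M false u w ws alt
  ... | pr , pr∈ , _ , last∈M = ¬-not λ end-o → o∉ (subst (_∈ (u ∷ w ∷ ws))
          (sym (proj₂ isM (endOf w ws) o pr end-o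
                 (trans (inM-sym M (endOf w ws) pr) (trans last∈M (not-injective even)))))
          pr∈)

  even-neighbour-odd : ∀ M → IsSymMatching K M → ∀ e o → EvenVia M e → KEdge K e o → OddVia M o
  even-neighbour-odd M isM e o (u , ws , u-free , U , refl , alt , even) eo with o ∈? (u ∷ ws)
  ... | yes o∈ with prefix M false u ws o o∈ U alt
  ...   | ws₁ , U₁ , ends , alt₁ , _ = u , ws₁ , u-free , U₁ , ends , alt₁ , xor≡not⇒true (side u) _ sides
    where
    sides : side u xor isOdd (length ws₁) ≡ not (side u)
    sides = begin
      side u xor isOdd (length ws₁) ≡⟨ side-endOf M false u ws₁ alt₁ ⟨
      side (endOf u ws₁)           ≡⟨ cong side ends ⟩
      side o                       ≡⟨ KEdge-side {K = K} (endOf u ws) o eo ⟩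
      not (side (endOf u ws))      ≡⟨ cong not (side-endOf M false u ws alt) ⟩
      not (side u xor isOdd (length ws)) ≡⟨ cong (λ b → not (side u xor b)) even ⟩
      not (side u xor false)       ≡⟨ cong not (xor-identityʳ (side u)) ⟩
      not (side u)                 ∎
      where open ≡-Reasoning
  even-neighbour-odd M isM e o (u , ws , u-free , U , refl , alt , even) eo | no o∉ =
    u , ws ++ [ o ] , u-free , snoc-unique (u ∷ ws) o U o∉ , snoc-endOf u ws o ,
    snoc-alt M false u ws o alt eo (trans (even-end-partner M isM u ws o u-free alt even o∉) (sym (cong (false xor_) even))) ,
    trans (snoc-isOdd ws o) (cong not even)

  odd-partner-even : ∀ M → IsSymMatching K M → ∀ v w → OddVia M v → inM M v w ≡ true → EvenVia M w
  odd-partner-even M isM v w (u , ws , u-free , U , refl , alt , odd) vw with w ∈? (u ∷ ws)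
  ... | yes w∈ with prefix M false u ws w w∈ U alt
  ...   | ws₁ , U₁ , ends , alt₁ , _ = u , ws₁ , u-free , U₁ , ends , alt₁ , xor≡id⇒false (side u) _ sides
    where
    sides : side u xor isOdd (length ws₁) ≡ side u
    sides = begin
      side u xor isOdd (length ws₁) ≡⟨ side-endOf M false u ws₁ alt₁ ⟨
      side (endOf u ws₁)           ≡⟨ cong side ends ⟩
      side w                       ≡⟨ KEdge-side {K = K} (endOf u ws) w (proj₁ isM (endOf u ws) w vw) ⟩
      not (side (endOf u ws))      ≡⟨ cong not (side-endOf M false u ws alt) ⟩
      not (side u xor isOdd (length ws)) ≡⟨ cong (λ b → not (side u xor b)) odd ⟩
      not (side u xor true)        ≡⟨ not-xor-true (side u) ⟩
      side u                       ∎
      where open ≡-Reasoning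
  odd-partner-even M isM v w (u , ws , u-free , U , refl , alt , odd) vw | no w∉ =
    u , ws ++ [ w ] , u-free , snoc-unique (u ∷ ws) w U w∉ , snoc-endOf u ws w ,
    snoc-alt M false u ws w alt (proj₁ isM (endOf u ws) w vw) (trans vw (sym (cong (false xor_) odd))) ,
    trans (snoc-isOdd ws w) (cong not odd)

  -- Every odd vertex has an even neighbour (its predecessor on the path).
  odd-has-even-neighbour : ∀ M → ∀ v → OddVia M v → ∃ λ e → EvenVia M e × KEdge K e v
  odd-has-even-neighbour M v (u , w ∷ ws , u-free , U , refl , alt , odd) with last-edge M false u w ws alt
  ... | pr , pr∈ , last , _ with prefix M false u (w ∷ ws) pr pr∈ U alt
  ...   | ws₁ , U₁ , ends , alt₁ , _ = pr , (u , ws₁ , u-free , U₁ , ends , alt₁ , xor≡id⇒false (side u) _ sides) , last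
    where
    sides : side u xor isOdd (length ws₁) ≡ side u
    sides = begin
      side u xor isOdd (length ws₁) ≡⟨ side-endOf M false u ws₁ alt₁ ⟨
      side (endOf u ws₁)           ≡⟨ cong side ends ⟩
      side pr                      ≡⟨ not-involutive (side pr) ⟨
      not (not (side pr))          ≡⟨ cong not (KEdge-side {K = K} pr (endOf w ws) last) ⟨
      not (side (endOf w ws))      ≡⟨ cong not (side-endOf M false u (w ∷ ws) alt) ⟩
      not (side u xor isOdd (length (w ∷ ws))) ≡⟨ cong (λ b → not (side u xor b)) odd ⟩
      not (side u xor true)        ≡⟨ not-xor-true (side u) ⟩
      side u                       ∎
      where open ≡-Reasoning

module _ {nA nP : ℕ} (K : ESet nA nP) where
  IsMax : EdgeSel nA nP → Set
  IsMax X = IsMaxMatching AllV K X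

  isSym : ∀ {X} → IsMax X → IsSymMatching K X
  isSym (isM , _) = fromIsMatching isM

  -- Odd vertices are covered by a maximum matching (else the path would be augmenting).
  odd-covered : ∀ X → IsMax X → ∀ v → OddVia K X v → Covered X v
  odd-covered X mX v (u , ws , u-free , U , ends , alt , odd) with covered? X v
  ... | inj₁ v-cov = v-cov
  ... | inj₂ v-free = ⊥-elim (maximum-no-augmenting K X (isSym mX) (proj₂ mX)
                        (u , ws , U , u-free , subst (Free X) (sym ends) v-free , alt , odd))

  -- An even vertex is free in some maximum matching: shift along its even path.
  even-freeable : ∀ X → IsMax X → ∀ v → EvenVia K X v → ∃ λ X′ → IsMax X′ × Free X′ v
  even-freeable X mX v (u , ws , u-free , U , ends , alt , even) =
    S.matching ,
    (toIsMatching S.isMatching , λ N isN → subst (size N ≤_) (sym S.size-same) (proj₂ mX N isN)) ,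
    subst (Free S.matching) ends S.end-free
    where module S = EvenShift (shift-even {K = K} X (isSym mX) u ws u-free alt U even)

  -- A vertex free in one maximum matching is even with respect to every maximum matching:
  -- the symmetric difference path from it cannot be augmenting.
  free-even-in-every : ∀ X → IsMax X → ∀ Y → IsMax Y → ∀ v → Free X v → EvenVia K Y v
  free-even-in-every X mX Y mY v v-free with covered? Y v
  ... | inj₂ v-freeY = free-even K Y v v-freeY
  ... | inj₁ v-cov with SymmetricDifference.component-path K X Y (isSym mX) (isSym mY) v v-free v-cov
  ... | e , t , U , ends , inj₁ (e-free , odd , altX , _) =
    ⊥-elim (maximum-no-augmenting K X (isSym mX) (proj₂ mX)
              (e , t , U , e-free , subst (Free X) (sym ends) v-free , altX , odd))
  ... | e , t , U , ends , inj₂ (e-free , even , altY , _) = e , t , e-free , U , ends , altY , even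

  even-independent : ∀ X → IsMax X → ∀ Y → IsMax Y → ∀ v → EvenVia K X v → EvenVia K Y v
  even-independent X mX Y mY v even with even-freeable X mX v even
  ... | X′ , mX′ , v-free = free-even-in-every X′ mX′ Y mY v v-free

  odd-independent : ∀ X → IsMax X → ∀ Y → IsMax Y → ∀ v → OddVia K Y v → OddVia K X v
  odd-independent X mX Y mY v odd with odd-has-even-neighbour K Y v odd
  ... | e , even , ev = even-neighbour-odd K X (isSym mX) e v (even-independent Y mY X mX e even) ev

  even-not-odd : ∀ X → IsMax X → ∀ v → EvenVia K X v → OddVia K X v → ⊥
  even-not-odd X mX v even odd with even-freeable X mX v even | odd-has-even-neighbour K X v odd
  ... | X′ , mX′ , v-free | e , even-e , ev =
    covered-free-⊥ X′ v
      (odd-covered X′ mX′ v (even-neighbour-odd K X′ (isSym mX′) e v (even-independent X mX X′ mX′ e even-e) ev))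
      v-free

  module Decomposition (X : EdgeSel nA nP) (mX : IsMax X) where
    odd⇒OddVia : ∀ v → OddSet AllV K v → OddVia K X v
    odd⇒OddVia v (Y , mY , odd) = odd-independent X mX Y mY v (OddWrt→OddVia K Y v odd)

    OddVia⇒odd : ∀ v → OddVia K X v → OddSet AllV K v
    OddVia⇒odd v odd = X , mX , OddVia→OddWrt K X v odd

    even⇒¬OU : ∀ v → EvenVia K X v → ¬ OU K v
    even⇒¬OU v even (inj₁ (Y , mY , odd)) =
      even-not-odd Y mY v (even-independent X mX Y mY v even) (OddWrt→OddVia K Y v odd)
    even⇒¬OU v even (inj₂ (_ , Y , mY , ¬even , _)) =
      ¬even (EvenVia→EvenWrt K Y v (even-independent X mX Y mY v even))

    -- Constructively, a vertex outside O ∪ U is "not not" even.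
    ¬OU⇒¬¬even : ∀ v → ¬ OU K v → ¬ ¬ EvenVia K X v
    ¬OU⇒¬¬even v ¬ou ¬even =
      ¬ou (inj₂ (tt , X , mX , (λ e → ¬even (EvenWrt→EvenVia K X v e)) , (λ o → ¬ou (inj₁ (X , mX , o)))))

    OU-covered : ∀ v → OU K v → Covered X v
    OU-covered v ou with covered? X v
    ... | inj₁ v-cov = v-cov
    ... | inj₂ v-free = ⊥-elim (even⇒¬OU v (free-even K X v v-free) ou)

    -- The X-partner of an odd vertex is even, hence neither odd nor unreachable.
    odd-partner-¬OU : ∀ v w → OddSet AllV K v → inM X v w ≡ true → ¬ OU K w
    odd-partner-¬OU v w odd vw = even⇒¬OU w (odd-partner-even K X (isSym mX) v w (odd⇒OddVia v odd) vw)

  -- A matching Y that covers every odd or unreachable vertex and matches no odd vertex to an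
  -- odd or unreachable one has no augmenting path: along an alternating path from a Y-free
  -- (hence even) vertex, non-Y edges lead from even to odd vertices and Y-edges from odd to
  -- even vertices, so an odd-length path ends at an odd, hence covered, vertex.
  respects-decomposition-no-augmenting : ∀ X → IsMax X → ∀ Y →
    (∀ s t → inM Y s t ≡ true → OddSet AllV K s → ¬ OU K t) →
    (∀ v → OU K v → Covered Y v) → AugmentingPath K Y → ⊥
  respects-decomposition-no-augmenting X mX Y odd-to-even covers (e , w ∷ t , _ , e-free , end-free , (ew , _ , alt) , _) =
    from-odd w t (λ ¬odd → ¬OU⇒¬¬even e (λ ou → covered-free-⊥ Y e (covers e ou) e-free)
                              (λ even → ¬odd (even-neighbour-odd K X (isSym mX) e w even ew)))
             alt end-free
    where
    open Decomposition X mX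
    from-even : ∀ h t → ¬ ¬ EvenVia K X h → Covered Y h → AltFrom K Y false h t → Free Y (endOf h t) → ⊥
    from-odd  : ∀ h t → ¬ ¬ OddVia K X h → AltFrom K Y true h t → Free Y (endOf h t) → ⊥
    from-even h [] _ h-cov _ h-free = covered-free-⊥ Y h h-cov h-free
    from-even h (w ∷ t) ¬¬even _ (hw , _ , alt) end-free =
      from-odd w t (λ ¬odd → ¬¬even (λ even → ¬odd (even-neighbour-odd K X (isSym mX) h w even hw))) alt end-free
    from-odd h [] ¬¬odd _ h-free = ¬¬odd (λ odd → covered-free-⊥ Y h (covers h (inj₁ (OddVia⇒odd h odd))) h-free)
    from-odd h (w ∷ t) ¬¬odd (_ , hw∈Y , alt) end-free =
      from-even w t (λ ¬even → ¬¬odd (λ odd → ¬OU⇒¬¬even w (odd-to-even h w hw∈Y (OddVia⇒odd h odd)) ¬even))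
                (h , trans (inM-sym Y w h) hw∈Y) alt end-free

module _ {nA nP : ℕ} where
  inM-⊆ : ∀ (X M : EdgeSel nA nP) → (∀ b q → X b q ≡ true → M b q ≡ true) →
          ∀ s t → inM X s t ≡ true → inM M s t ≡ true
  inM-⊆ X M X⊆M (inj₁ b) (inj₂ q) st = X⊆M b q st
  inM-⊆ X M X⊆M (inj₂ q) (inj₁ b) st = X⊆M b q st

  sub-matching : ∀ {K K′ : ESet nA nP} {X M} → IsSymMatching K′ M →
    (∀ b q → X b q ≡ true → M b q ≡ true) → (∀ b q → X b q ≡ true → K b q) → IsSymMatching K X
  sub-matching {K = K} {X = X} {M} isM X⊆M X⊆K = inK , λ s t t′ st st′ →
    proj₂ isM s t t′ (inM-⊆ X M X⊆M s t st) (inM-⊆ X M X⊆M s t′ st′)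
    where
    inK : ∀ s t → inM X s t ≡ true → KEdge K s t
    inK (inj₁ b) (inj₂ q) st = X⊆K b q st
    inK (inj₂ q) (inj₁ b) st = X⊆K b q st

  matching-edge : ∀ {K : ESet nA nP} {X} → IsSymMatching K X → ∀ b q → X b q ≡ true → K b q
  matching-edge isX b q bq = proj₁ isX (inj₁ b) (inj₂ q) bq

  matching-mono : ∀ {K K′ : ESet nA nP} {X} → IsSymMatching K X → (∀ b q → K b q → K′ b q) →
                  IsSymMatching K′ X
  matching-mono isX K⊆K′ = sub-matching isX (λ _ _ bq → bq) (λ b q bq → K⊆K′ b q (matching-edge isX b q bq))

rank≤maxRank : ∀ {nA nP} (r : Ranking nA nP) b q → r b q ≤ maxRank r
rank≤maxRank {nA} {nP} r b q =
  ≤-trans (∈-foldr⊔ _ (∈-map⁺ (λ p → r b p) (∈-allFin q)))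
          (∈-foldr⊔ _ (∈-map⁺ (λ a → foldr _⊔_ 0 (map (λ p → r a p) (allFin nP))) (∈-allFin b)))
  where
  ∈-foldr⊔ : ∀ {x} xs → x ∈ xs → x ≤ foldr _⊔_ 0 xs
  ∈-foldr⊔ (y ∷ ys) (here refl) = m≤m⊔n y _
  ∈-foldr⊔ (y ∷ ys) (there x∈) = ≤-trans (∈-foldr⊔ ys x∈) (m≤n⊔m y _)

≤ᵇ-split : ∀ r m → bit (r ≤ᵇ suc m) ≡ bit (r ≤ᵇ m) + bit (does (r Data.Nat.≟ suc m))
≤ᵇ-split zero m = refl
≤ᵇ-split (suc zero) zero = refl
≤ᵇ-split (suc (suc r)) zero = refl
≤ᵇ-split (suc zero) (suc m) = refl
≤ᵇ-split (suc (suc r)) (suc m) = ≤ᵇ-split (suc r) m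

module Restriction {nA nP : ℕ} (r : Ranking nA nP) where
  below : EdgeSel nA nP → ℕ → EdgeSel nA nP
  below X m b q = X b q ∧ (r b q ≤ᵇ m)

  below-true : ∀ X {m b q} → below X m b q ≡ true → X b q ≡ true × r b q ≤ m
  below-true X {m} {b} {q} bq with X b q
  ... | true = refl , ≤ᵇ⇒≤ (r b q) m (Equivalence.from T-≡ bq)

  below-intro : ∀ X {m b q} → X b q ≡ true → r b q ≤ m → below X m b q ≡ true
  below-intro X bq le rewrite bq = Equivalence.to T-≡ (≤⇒≤ᵇ le)

  below-split : ∀ X m → edgeCount (below X (suc m)) ≡ edgeCount (below X m) + sigEntry r X (suc m)
  below-split X m = edgeCount-+ (below X m) (λ b q → X b q ∧ does (r b q Data.Nat.≟ suc m)) (below X (suc m)) split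
    where
    split : ∀ b q → bit (below X (suc m) b q) ≡ bit (below X m b q) + bit (X b q ∧ does (r b q Data.Nat.≟ suc m))
    split b q with X b q
    ... | true = ≤ᵇ-split (r b q) m
    ... | false = refl

  below-zero : ∀ X → (∀ b q → X b q ≡ true → 1 ≤ r b q) → edgeCount (below X 0) ≡ 0
  below-zero X positive = edgeCount-zero λ b q → ¬-not λ bq →
    let (bq∈X , r≤0) = below-true X bq in <⇒≱ (positive b q bq∈X) r≤0

  below-all : ∀ X m → (∀ b q → X b q ≡ true → r b q ≤ m) → edgeCount (below X m) ≡ edgeCount X
  below-all X m low = edgeCount-cong λ b q → ⇔→≡ {z = true} (mk⇔ (λ bq → proj₁ (below-true X bq))
                                                                   (λ bq → below-intro X bq (low b q bq)))

  lex-improvement : ∀ X Y j → suc j ≤ maxRank r →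
    (∀ m → m ≤ j → edgeCount (below Y m) ≡ edgeCount (below X m)) →
    edgeCount (below Y (suc j)) ≡ suc (edgeCount (below X (suc j))) →
    LexLess (maxRank r) (sigEntry r X) (sigEntry r Y)
  lex-improvement X Y j bound same one-more = suc j , s≤s z≤n , bound , equal , ≤-reflexive larger
    where
    equal : ∀ m → 1 ≤ m → m < suc j → sigEntry r X m ≡ sigEntry r Y m
    equal (suc m) _ (s≤s m<j) = +-cancelˡ-≡ (edgeCount (below X m)) _ _ (begin
      edgeCount (below X m) + sigEntry r X (suc m)   ≡⟨ below-split X m ⟨
      edgeCount (below X (suc m))                   ≡⟨ same (suc m) m<j ⟨
      edgeCount (below Y (suc m))                   ≡⟨ below-split Y m ⟩
      edgeCount (below Y m) + sigEntry r Y (suc m)   ≡⟨ cong (_+ sigEntry r Y (suc m)) (same m (≤-trans (n≤1+n m) m<j)) ⟩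
      edgeCount (below X m) + sigEntry r Y (suc m)   ∎)
      where open ≡-Reasoning
    larger : suc (sigEntry r X (suc j)) ≡ sigEntry r Y (suc j)
    larger = +-cancelˡ-≡ (edgeCount (below X j)) _ _ (begin
      edgeCount (below X j) + suc (sigEntry r X (suc j)) ≡⟨ +-suc _ _ ⟩
      suc (edgeCount (below X j) + sigEntry r X (suc j)) ≡⟨ cong suc (below-split X j) ⟨
      suc (edgeCount (below X (suc j)))                 ≡⟨ one-more ⟨
      edgeCount (below Y (suc j))                       ≡⟨ below-split Y j ⟩
      edgeCount (below Y j) + sigEntry r Y (suc j)       ≡⟨ cong (_+ sigEntry r Y (suc j)) (same j ≤-refl) ⟩
      edgeCount (below X j) + sigEntry r Y (suc j)       ∎)
      where open ≡-Reasoning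

module Reduction {nA nP : ℕ} (rk : Ranking nA nP) where
  open Restriction rk

  current-edge : ∀ j b q → current rk j b q → 1 ≤ rk b q
  current-edge zero b q bq = bq
  current-edge (suc zero) b q bq = bq
  current-edge (suc (suc k)) b q bq = current-edge (suc k) b q (proj₁ bq)

  current-antitone : ∀ {m} j → 1 ≤ m → m ≤ j → ∀ b q → current rk j b q → current rk m b q
  current-antitone j 1≤m m≤j b q bq with m≤n⇒m<n∨m≡n m≤j
  ... | inj₂ refl = bq
  current-antitone (suc zero) 1≤m _ b q bq | inj₁ (s≤s m≤0) = ⊥-elim (<⇒≱ 1≤m m≤0)
  current-antitone (suc (suc k)) 1≤m m≤j b q bq | inj₁ (s≤s m≤k+1) =
    current-antitone (suc k) 1≤m m≤k+1 b q (proj₁ bq)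

  -- Lemma A.  Then no edge of N is deleted in iteration
  -- k + 1: odd and unreachable vertices are covered by low-rank edges of N, and the low-rank
  -- partner of an odd vertex is even.
  survives-iteration : ∀ k N → IsSymMatching (current rk (suc k)) N →
    IsMax (reduced rk (suc k)) (below N (suc k)) → ∀ b q → N b q ≡ true → current rk (suc (suc k)) b q
  survives-iteration k N isN maxN b q bq = matching-edge isN b q bq , not-high , not-low
    where
    K = reduced rk (suc k)
    open Decomposition K (below N (suc k)) maxN
    not-high : ¬ (suc k < rk b q × (OU K (inj₁ b) ⊎ OU K (inj₂ q)))
    not-high (high , inj₁ ou) with OU-covered (inj₁ b) ou
    ... | inj₂ q′ , bq′ with below-true N bq′
    ... | bq′∈N , low with proj₂ isN (inj₁ b) (inj₂ q) (inj₂ q′) bq bq′∈N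
    ... | refl = <⇒≱ high low
    not-high (high , inj₂ ou) with OU-covered (inj₂ q) ou
    ... | inj₁ b′ , b′q with below-true N b′q
    ... | b′q∈N , low with proj₂ isN (inj₂ q) (inj₁ b) (inj₁ b′) bq b′q∈N
    ... | refl = <⇒≱ high low
    not-low : ¬ (rk b q ≤ suc k × ((OddSet AllV K (inj₁ b) × OU K (inj₂ q)) ⊎
                                  (OddSet AllV K (inj₂ q) × OU K (inj₁ b))))
    not-low (low , inj₁ (odd , ou)) = odd-partner-¬OU (inj₁ b) (inj₂ q) odd (below-intro N bq low) ou
    not-low (low , inj₂ (odd , ou)) = odd-partner-¬OU (inj₂ q) (inj₁ b) odd (below-intro N bq low) ou

  -- Lemma B.  Then its edges of rank ≤ k + 1 form a matching of G'_{k+1}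
  -- as large as a maximum one X: the covering edges survived, so have rank ≤ k + 1, and no
  -- edge joins an odd vertex to an odd or unreachable one, so there is no augmenting path.
  restriction-maximum : ∀ k X Z → IsMax (reduced rk (suc k)) X →
    IsSymMatching (current rk (suc (suc k))) Z → (∀ v → OU (reduced rk (suc k)) v → Covered Z v) →
    edgeCount (below Z (suc k)) ≡ edgeCount X
  restriction-maximum k X Z maxX isZ covers =
    ≤-antisym (proj₂ maxX Y (toIsMatching isY))
              (≮⇒≥ λ Y<X → respects-decomposition-no-augmenting K X maxX Y odd-to-even covered
                             (berge K Y X isY (isSym K maxX) Y<X))
    where
    K = reduced rk (suc k)
    Y = below Z (suc k)
    isY : IsSymMatching K Y
    isY = sub-matching isZ (λ b q bq → proj₁ (below-true Z bq))
            (λ b q bq → let (bq∈Z , low) = below-true Z bq in proj₁ (matching-edge isZ b q bq∈Z) , low)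
    low-at-OU : ∀ b q → current rk (suc (suc k)) b q → OU K (inj₁ b) ⊎ OU K (inj₂ q) → rk b q ≤ suc k
    low-at-OU b q (_ , not-high , _) ou = ≮⇒≥ λ high → not-high (high , ou)
    covered : ∀ v → OU K v → Covered Y v
    covered (inj₁ b) ou with covers (inj₁ b) ou
    ... | inj₂ q , bq = inj₂ q , below-intro Z bq (low-at-OU b q (matching-edge isZ b q bq) (inj₁ ou))
    covered (inj₂ q) ou with covers (inj₂ q) ou
    ... | inj₁ b , bq = inj₁ b , below-intro Z bq (low-at-OU b q (matching-edge isZ b q bq) (inj₂ ou))
    odd-to-even : ∀ s t → inM Y s t ≡ true → OddSet AllV K s → ¬ OU K t
    odd-to-even (inj₁ b) (inj₂ q) bq odd ou with below-true Z bq
    ... | bq∈Z , low = proj₂ (proj₂ (matching-edge isZ b q bq∈Z)) (low , inj₁ (odd , ou))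
    odd-to-even (inj₂ q) (inj₁ b) bq odd ou with below-true Z bq
    ... | bq∈Z , low = proj₂ (proj₂ (matching-edge isZ b q bq∈Z)) (low , inj₂ (odd , ou))

module RankMaximalWithNewEdge {nA nP : ℕ} (rk : Ranking nA nP) (a : Fin nA) (p : Fin nP) (i c : ℕ)
    (not-edge : rk a p ≡ 0) (i<c : i < c) (M : EdgeSel nA nP)
    (M-rm : RankMaximal (addEdge rk a p c) M) (ap∈M : M a p ≡ true) where

  r̂ : Ranking nA nP
  r̂ = addEdge rk a p c

  open Reduction rk
  module G = Restriction rk
  module Ĝ = Restriction r̂

  isM : IsSymMatching (IsEdge r̂) M
  isM = fromIsMatching (proj₁ M-rm)

  r̂-new : r̂ a p ≡ c
  r̂-new = update-hit rk a p c

  r̂-low : ∀ b q → r̂ b q ≤ i → r̂ b q ≡ rk b q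
  r̂-low b q low = update-miss rk a p c b q λ { (refl , refl) → <⇒≱ i<c (subst (_≤ i) r̂-new low) }

  r̂-G : ∀ b q → 1 ≤ rk b q → r̂ b q ≡ rk b q
  r̂-G b q edge = update-miss rk a p c b q λ { (refl , refl) → <-irrefl refl (subst (1 ≤_) not-edge edge) }

  M° : EdgeSel nA nP
  M° = Ĝ.below M i

  N : ℕ → EdgeSel nA nP
  N j = G.below M° j

  M°-G-edge : ∀ b q → M° b q ≡ true → 1 ≤ rk b q
  M°-G-edge b q bq = let (bq∈M , low) = Ĝ.below-true M bq in
    subst (1 ≤_) (r̂-low b q low) (matching-edge isM b q bq∈M)

  N-mono : ∀ {k j} → k ≤ j → ∀ b q → N k b q ≡ true → N j b q ≡ true
  N-mono k≤j b q bq = let (bq∈M° , low) = G.below-true M° bq in G.below-intro M° bq∈M° (≤-trans low k≤j)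

  N-count : ∀ j → j ≤ i → edgeCount (N j) ≡ edgeCount (Ĝ.below M j)
  N-count j j≤i = edgeCount-cong λ b q → ⇔→≡ {z = true} (mk⇔ (to b q) (from b q))
    where
    to : ∀ b q → N j b q ≡ true → Ĝ.below M j b q ≡ true
    to b q bq with G.below-true M° bq
    ... | bq∈M° , low with Ĝ.below-true M bq∈M°
    ... | bq∈M , low-i = Ĝ.below-intro M bq∈M (subst (_≤ j) (sym (r̂-low b q low-i)) low)
    from : ∀ b q → Ĝ.below M j b q ≡ true → N j b q ≡ true
    from b q bq with Ĝ.below-true M bq
    ... | bq∈M , low = G.below-intro M° (Ĝ.below-intro M bq∈M (≤-trans low j≤i))
                                     (subst (_≤ j) (r̂-low b q (≤-trans low j≤i)) low)

  G-count : ∀ X → (∀ b q → X b q ≡ true → 1 ≤ rk b q) → ∀ m →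
            edgeCount (Ĝ.below X m) ≡ edgeCount (G.below X m)
  G-count X in-G m = edgeCount-cong same
    where
    same : ∀ b q → Ĝ.below X m b q ≡ G.below X m b q
    same b q with X b q in bq
    ... | true = cong (_≤ᵇ m) (r̂-G b q (in-G b q bq))
    ... | false = refl

  -- The invariants (S_j) and (T_j).
  Survives : ℕ → Set
  Survives j = ∀ b q → M° b q ≡ true → current rk j b q

  Invariant : ℕ → Set
  Invariant j = Survives j × IsMax (reduced rk j) (N j)

  Invariants≤ : ℕ → Set
  Invariants≤ j = ∀ k → 1 ≤ k → k ≤ j → Invariant k

  N-matching : ∀ j → Survives j → IsSymMatching (reduced rk j) (N j)
  N-matching j surv = sub-matching isM
    (λ b q bq → proj₁ (Ĝ.below-true M (proj₁ (G.below-true M° bq))))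
    (λ b q bq → let (bq∈M° , low) = G.below-true M° bq in surv b q bq∈M° , low)

  -- (S_{j+1}) follows from (T_j) by Lemma A.
  survives : ∀ j → Invariants≤ j → Survives (suc j)
  survives zero _ b q bq = M°-G-edge b q bq
  survives (suc k) earlier = survives-iteration k M°
    (sub-matching isM (λ b q bq → proj₁ (Ĝ.below-true M bq)) surv) maxN
    where
    surv = proj₁ (earlier (suc k) (s≤s z≤n) ≤-refl)
    maxN = proj₂ (earlier (suc k) (s≤s z≤n) ≤-refl)

  reduced-in-G : ∀ j b q → reduced rk j b q → 1 ≤ rk b q
  reduced-in-G j b q bq = current-edge j b q (proj₁ bq)

  -- Let N′ be a matching of G'_{j+1} covering whatever N_{j+1} covers.  By Lemma B its
  -- restriction to ranks ≤ k is as large as N_k, for every k ≤ j.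
  restrictions-maximum : ∀ j → Invariants≤ j → ∀ N′ → IsSymMatching (reduced rk (suc j)) N′ →
    (∀ v → Covered (N (suc j)) v → Covered N′ v) → ∀ k → k ≤ j → edgeCount (G.below N′ k) ≡ edgeCount (N k)
  restrictions-maximum j earlier N′ isN′ covers zero _ =
    trans (G.below-zero N′ λ b q bq → reduced-in-G (suc j) b q (matching-edge isN′ b q bq))
          (sym (G.below-zero M° M°-G-edge))
  restrictions-maximum j earlier N′ isN′ covers (suc k) k<j =
    restriction-maximum k (N (suc k)) N′ maxN
      (matching-mono isN′ λ b q bq → current-antitone (suc j) (s≤s z≤n) (s≤s k<j) b q (proj₁ bq))
      (λ v ou → covers v (lift v (Decomposition.OU-covered (reduced rk (suc k)) (N (suc k)) maxN v ou)))
    where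
    maxN = proj₂ (earlier (suc k) (s≤s z≤n) k<j)
    lift : ∀ v → Covered (N (suc k)) v → Covered (N (suc j)) v
    lift v (w , vw) = w , inM-⊆ (N (suc k)) (N (suc j)) (N-mono (≤-trans (n≤1+n _) (s≤s k<j))) v w vw

  improves-M : ∀ j → suc j ≤ i → Invariants≤ j → ∀ N′ → IsSymMatching (reduced rk (suc j)) N′ →
    edgeCount N′ ≡ suc (edgeCount (N (suc j))) → (∀ v → Covered (N (suc j)) v → Covered N′ v) →
    MatchingOf r̂ N′ × LexLess (maxRank r̂) (sigEntry r̂ M) (sigEntry r̂ N′)
  improves-M j j<i earlier N′ isN′ larger covers =
    toIsMatching (matching-mono isN′ in-Ĝ) , Ĝ.lex-improvement M N′ j bound same one-more
    where
    in-Ĝ : ∀ b q → reduced rk (suc j) b q → IsEdge r̂ b q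
    in-Ĝ b q bq = subst (1 ≤_) (sym (r̂-G b q (reduced-in-G (suc j) b q bq))) (reduced-in-G (suc j) b q bq)
    N′-in-G : ∀ b q → N′ b q ≡ true → 1 ≤ rk b q
    N′-in-G b q bq = reduced-in-G (suc j) b q (matching-edge isN′ b q bq)
    same : ∀ m → m ≤ j → edgeCount (Ĝ.below N′ m) ≡ edgeCount (Ĝ.below M m)
    same m m≤j = begin
      edgeCount (Ĝ.below N′ m) ≡⟨ G-count N′ N′-in-G m ⟩
      edgeCount (G.below N′ m) ≡⟨ restrictions-maximum j earlier N′ isN′ covers m m≤j ⟩
      edgeCount (N m)          ≡⟨ N-count m (≤-trans m≤j (≤-trans (n≤1+n j) j<i)) ⟩
      edgeCount (Ĝ.below M m)  ∎
      where open ≡-Reasoning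
    one-more : edgeCount (Ĝ.below N′ (suc j)) ≡ suc (edgeCount (Ĝ.below M (suc j)))
    one-more = begin
      edgeCount (Ĝ.below N′ (suc j)) ≡⟨ G-count N′ N′-in-G (suc j) ⟩
      edgeCount (G.below N′ (suc j)) ≡⟨ G.below-all N′ (suc j) (λ b q bq → proj₂ (matching-edge isN′ b q bq)) ⟩
      edgeCount N′                   ≡⟨ larger ⟩
      suc (edgeCount (N (suc j)))    ≡⟨ cong suc (N-count (suc j) j<i) ⟩
      suc (edgeCount (Ĝ.below M (suc j))) ∎
      where open ≡-Reasoning
    bound : suc j ≤ maxRank r̂
    bound = ≤-trans j<i (≤-trans (<⇒≤ i<c) (subst (_≤ maxRank r̂) r̂-new (rank≤maxRank r̂ a p)))

  -- (T_{j+1}): an augmenting path for N_{j+1} in G'_{j+1} would contradict rank-maximality.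
  maximum-next : ∀ j → suc j ≤ i → Invariants≤ j → Survives (suc j) → IsMax (reduced rk (suc j)) (N (suc j))
  maximum-next j j<i earlier surv =
    toIsMatching isN , λ L isL → ≮⇒≥ λ N<L → no-augmenting (berge K (N (suc j)) L isN (fromIsMatching isL) N<L)
    where
    K = reduced rk (suc j)
    isN = N-matching (suc j) surv
    no-augmenting : AugmentingPath K (N (suc j)) → ⊥
    no-augmenting (e , t , U , e-free , end-free , alt , odd) =
      proj₂ M-rm Aug.matching (proj₁ better) (proj₂ better)
      where
      module Aug = Augmentation (augment {K = K} (N (suc j)) isN e t e-free alt U odd end-free)
      better = improves-M j j<i earlier Aug.matching Aug.isMatching Aug.size-suc Aug.covered-preserved

  invariants : ∀ j → j ≤ i → Invariants≤ j
  invariants zero _ k 1≤k k≤0 = ⊥-elim (<⇒≱ 1≤k k≤0)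
  invariants (suc j) j<i k 1≤k k≤j+1 with m≤n⇒m<n∨m≡n k≤j+1
  ... | inj₁ (s≤s k≤j) = invariants j (≤-trans (n≤1+n j) j<i) k 1≤k k≤j
  ... | inj₂ refl = survives j earlier , maximum-next j j<i earlier (survives j earlier)
    where earlier = invariants j (≤-trans (n≤1+n j) j<i)

  -- a is free in N_i, because its M-edge (a,p) has rank c > i.
  a-free : Free (N i) (inj₁ a)
  a-free (inj₁ _) = refl
  a-free (inj₂ q) = ¬-not λ aq → let (aq∈M , low) = Ĝ.below-true M (proj₁ (G.below-true M° aq)) in
    not-p aq∈M low
    where
    not-p : M a q ≡ true → r̂ a q ≤ i → ⊥
    not-p aq∈M low with proj₂ isM (inj₁ a) (inj₂ p) (inj₂ q) ap∈M aq∈M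
    ... | refl = <⇒≱ i<c (subst (_≤ i) r̂-new low)

  -- Hence a is even in G'_i, so it cannot be unreachable.
  not-unreachable : 1 ≤ i → UnreachSet AllV (reduced rk i) (inj₁ a) → ⊥
  not-unreachable 1≤i (_ , M₀ , maxM₀ , ¬even , _) =
    ¬even (EvenVia→EvenWrt K M₀ (inj₁ a) (free-even-in-every K (N i) maxN M₀ maxM₀ (inj₁ a) a-free))
    where
    K = reduced rk i
    maxN = proj₂ (invariants i ≤-refl i 1≤i ≤-refl)

-- The theorem.
corollary2 : ∀ {nA nP : ℕ} (rk : Ranking nA nP) (a : Fin nA) (p' p : Fin nP) (i c : ℕ) →
    rk a p' ≡ 1 → fPost rk a p' →
    1 ≤ i → i ≤ maxRank rk → UnreachSet AllV (reduced rk i) (inj₁ a) →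
    rk a p ≡ 0 → i < c →
    ∀ (M : EdgeSel nA nP) → RankMaximal (addEdge rk a p c) M → M a p ≡ false
corollary2 rk a p' p i c _ _ 1≤i _ unreachable not-edge i<c M M-rm with M a p in ap∈M
... | false = refl
... | true = ⊥-elim (RankMaximalWithNewEdge.not-unreachable rk a p i c not-edge i<c M M-rm ap∈M 1≤i unreachable)
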